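{- Let $\Gamma$ be the set of words $w\in\Gamma_0^*$ such that $w=w_0[\alpha,\beta]$ for some maximal free interval $[\alpha,\beta]$ of $w_0$. Then $\Gamma\subseteq\Gamma_0^+$, $|\Gamma|\le 2d-2$, and $\Gamma$ is closed under the involution.
   Context: Let $\Gamma_0$ be a finite alphabet with involution $a\mapsto\overline a$ (fixed points allowed), extended to words by $\overline{a_1\cdots a_k}=\overline{a_k}\cdots\overline{a_1}$, and $\Omega_0$ a finite set of variables with fixed-point-free involution. Let $x_1,\dots,x_d\in\Gamma_0\cup\Omega_0$ with $2\le g<d$, and let $\sigma:\Omega_0\to\Gamma_0^*$ with $\sigma(\overline X)=\overline{\sigma(X)}$ (extended to a homomorphism fixing $\Gamma_0$) satisfy $\sigma(x_1\cdots x_g)=\sigma(x_{g+1}\cdots x_d)=:w_0$ and $\sigma(x_i)\ne1$ for all $i$. Let $m_0=|w_0|$. Positions of $w=a_1\cdots a_m$ are $0,\dots,m$; for $0\le\alpha<\beta\le m$ set $w[\alpha,\beta]=a_{\alpha+1}\cdots a_\beta$, $w[\beta,\alpha]=\overline{w[\alpha,\beta]}$, $w[\alpha,\alpha]=1$; an interval is any pair $[\alpha,\beta]$ of positions. For $1\le i\le g$ let $\mathrm{l}(i)=|\sigma(x_1\cdots x_{i-1})|$, for $g<i\le d$ let $\mathrm{l}(i)=|\sigma(x_{g+1}\cdots x_{i-1})|$, and $\mathrm{r}(i)=\mathrm{l}(i)+|\sigma(x_i)|$. The cuts are the positions $\mathrm{l}(i),\mathrm{r}(i)$, $1\le i\le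 d$. For $i,j$ and $\mu,\nu\in\{0,\dots,\mathrm{r}(i)-\mathrm{l}(i)\}$ define $[\mathrm{l}(i)+\mu,\mathrm{l}(i)+\nu]\sim[\mathrm{l}(j)+\mu,\mathrm{l}(j)+\nu]$ if $x_i=x_j$, and $[\mathrm{l}(i)+\mu,\mathrm{l}(i)+\nu]\sim[\mathrm{r}(j)-\mu,\mathrm{r}(j)-\nu]$ if $x_i=\overline{x_j}$; let $\approx$ be the reflexive transitive closure of $\sim$. An interval $[\alpha,\beta]$ is free if for every $[\alpha',\beta']\approx[\alpha,\beta]$ there is no cut $\gamma'$ with $\min\{\alpha',\beta'\}<\gamma'<\max\{\alpha',\beta'\}$. A free interval $[\alpha,\beta]$ is maximal free if there is no free interval $[\alpha',\beta']$ with $\alpha'\le\min\{\alpha,\beta\}\le\max\{\alpha,\beta\}\le\beta'$ and $\beta'-\alpha'>|\beta-\alpha|$. -}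

module Defs where

open import Data.Nat using (ℕ; zero; suc; _+_; _∸_; _≤_; _<_; _⊔_; _⊓_; ∣_-_∣)
open import Data.Nat.Properties using (_≤?_)
open import Data.Fin using (Fin; toℕ)
open import Data.List using (List; []; _∷_; [_]; length; map; reverse; take; drop; concat; tabulate)
open import Data.Nat.ListAction using (sum)
open import Data.Sum using (_⊎_; inj₁; inj₂)
open import Data.Product using (_×_; _,_; Σ; ∃; ∃-syntax)
open import Relation.Nullary using (¬_; yes; no)
open import Relation.Binary.PropositionalEquality using (_≡_)
open import Relation.Binary.Construct.Closure.ReflexiveTransitive using (Star)

-- Letters of Γ₀ are Fin n, variables of Ω₀ are Fin k.

barW : ∀ {n} → (Fin n → Fin n) → List (Fin n) → List (Fin n)
barW barΓ w = reverse (map barΓ w)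

-- w[α,β] for positions α, β (0-based positions 0..|w|).
sub : ∀ {n} → (Fin n → Fin n) → List (Fin n) → ℕ → ℕ → List (Fin n)
sub barΓ w α β with α ≤? β
... | yes _ = take (β ∸ α) (drop α w)
... | no  _ = barW barΓ (take (α ∸ β) (drop β w))

module Setting {n k : ℕ}
  (barΓ : Fin n → Fin n)
  (barΩ : Fin k → Fin k)
  (σ : Fin k → List (Fin n))
  {d : ℕ} (x : Fin d → Fin n ⊎ Fin k)   -- x₁, …, x_d  (0-indexed)
  (g : ℕ)
  where

  barL : Fin n ⊎ Fin k → Fin n ⊎ Fin k
  barL (inj₁ a) = inj₁ (barΓ a)
  barL (inj₂ X) = inj₂ (barΩ X)

  σL : Fin n ⊎ Fin k → List (Fin n)
  σL (inj₁ a) = [ a ]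
  σL (inj₂ X) = σ X

  σx : List (List (Fin n))
  σx = tabulate (λ i → σL (x i))

  leftWord : List (Fin n)
  leftWord = concat (take g σx)

  rightWord : List (Fin n)
  rightWord = concat (drop g σx)

  lens : List ℕ
  lens = map length σx

  len : Fin d → ℕ
  len i = length (σL (x i))

  -- l(i) (with i 0-indexed: paper's index is toℕ i + 1)
  l : Fin d → ℕ
  l i with suc (toℕ i) ≤? g
  ... | yes _ = sum (take (toℕ i) lens)
  ... | no  _ = sum (take (toℕ i ∸ g) (drop g lens))

  r : Fin d → ℕ
  r i = l i + len i

  IsCut : ℕ → Set
  IsCut γ = ∃[ i ] (γ ≡ l i ⊎ γ ≡ r i)

  Interval : Set
  Interval = ℕ × ℕ

  data _∼_ : Interval → Interval → Set where
    same : ∀ i j μ ν → μ ≤ len i → ν ≤ len i → x i ≡ x j →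
           (l i + μ , l i + ν) ∼ (l j + μ , l j + ν)
    dual : ∀ i j μ ν → μ ≤ len i → ν ≤ len i → x i ≡ barL (x j) →
           (l i + μ , l i + ν) ∼ (r j ∸ μ , r j ∸ ν)

  _≈_ : Interval → Interval → Set
  _≈_ = Star _∼_

  module _ (w₀ : List (Fin n)) where

    IsInterval : Interval → Set
    IsInterval (α , β) = α ≤ length w₀ × β ≤ length w₀

    Free : Interval → Set
    Free (α , β) = IsInterval (α , β) ×
      (∀ α' β' → (α , β) ≈ (α' , β') →
        ∀ γ → IsCut γ → ¬ ((α' ⊓ β') < γ × γ < (α' ⊔ β')))

    MaximalFree : Interval → Set
    MaximalFree (α , β) = Free (α , β) ×
      ¬ (∃[ α' ] ∃[ β' ] (Free (α' , β') × α' ≤ (α ⊓ β) × (α ⊔ β) ≤ β' ×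
                          ∣ β - α ∣ < β' ∸ α'))

    InΓ : List (Fin n) → Set
    InΓ w = ∃[ α ] ∃[ β ] (MaximalFree (α , β) × w ≡ sub barΓ w₀ α β)

{-# OPTIONS --safe #-}

-- A step of ∼ maps a block σ(x_i) onto a block σ(x_j) by a translation (x_i = x_j) or a
-- reflection (x_i = overline x_j); both preserve words, freeness, betweenness and adjacency.
-- Unit intervals are free, so a maximal free interval is never degenerate, and swapping its
-- endpoints gives the involution. If no interval ≈ [α, β] began at a cut, [α, β] could be
-- widened by one position at α and stay free; so a maximal free interval is ≈ some [p, q]
-- with p a cut. Then [p, q] is the longest free interval leaving p in its direction:
-- otherwise q would lie strictly inside a longer one, and carrying that along to an image
-- [p′, q′] with q′ a cut (which exists by the same argument at the other end) would put a
-- cut strictly inside a free interval. Below m the cuts are the d − 1 values l(i), i ≠ g + 1,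
-- above 0 the d − 1 values r(i), i ≠ g, which leaves at most 2d − 2 words.
module Submission where

open import Defs
open import Data.Empty using (⊥; ⊥-elim)
open import Data.Fin using (Fin; toℕ; fromℕ; fromℕ<; punchIn; punchOut)
  renaming (zero to fzero; suc to fsuc; _≟_ to _≟ᶠ_)
open import Data.Fin.Properties using (toℕ-fromℕ; toℕ-fromℕ<; toℕ<n; punchIn-punchOut)
  renaming (any? to any-Fin?; all? to all-Fin?)
open import Data.List
  using (List; []; _∷_; [_]; _++_; length; map; reverse; take; drop; concat; tabulate; cartesianProduct; upTo)
open import Data.List.Membership.Propositional using (_∈_)
open import Data.List.Membership.Propositional.Properties
  using (∈-cartesianProduct⁺; ∈-upTo⁺; ∈-tabulate⁺; ∈-++⁺ˡ; ∈-++⁺ʳ)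
import Data.List.Membership.DecPropositional as DecMembership
open import Data.List.Properties
  using (length-++; length-map; length-reverse; length-take; length-drop; length-tabulate; reverse-++;
         reverse-involutive; reverse-map; map-∘; map-id; map-cong; ≡-dec; take++drop≡id; ++-assoc; ++-identityʳ;
         concat-++; take-map; drop-map; drop-drop; take-take; take-all)
open import Data.List.Relation.Unary.All as All using (all?)
open import Data.List.Relation.Unary.All.Properties using (¬All⇒Any¬)
open import Data.List.Relation.Unary.Any as Any using (Any; here; there; any?)
open import Data.Nat
  using (ℕ; zero; suc; pred; >-nonZero; ≢-nonZero; _+_; _*_; _∸_; _≤_; _<_; _⊓_; _⊔_; ∣_-_∣; z≤n; s≤s; _≟_; _<?_)
open import Data.Nat.ListAction using (sum)
open import Data.Nat.Properties
open import Data.Product using (_×_; _,_; Σ; ∃-syntax; proj₁; proj₂; map₁; map₂)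
open import Data.Product.Properties using () renaming (≡-dec to ×-≡-dec)
open import Data.Sum using (_⊎_; inj₁; inj₂)
open import Data.Sum.Properties using () renaming (≡-dec to ⊎-≡-dec)
open import Function using (_∘_)
open import Relation.Binary.Construct.Closure.ReflexiveTransitive as Star using (Star; ε; _◅_; _◅◅_)
open import Relation.Binary.Definitions using (DecidableEquality; tri<; tri≈; tri>)
open import Relation.Binary.PropositionalEquality
  using (_≡_; _≢_; ≢-sym; refl; sym; trans; cong; cong₂; subst; subst₂; module ≡-Reasoning)
open import Relation.Nullary using (¬_; Dec; yes; no)
open import Relation.Nullary.Decidable using (_×-dec_; _⊎-dec_; _→-dec_; ¬?; map′; decidable-stable)

-- Slices of lists

module _ {A : Set} where

  length-concat : (xss : List (List A)) → length (concat xss) ≡ sum (map length xss)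
  length-concat [] = refl
  length-concat (xs ∷ xss) = trans (length-++ xs) (cong (length xs +_) (length-concat xss))

  drop-tabulate : ∀ {d} (f : Fin d → A) (i : Fin d) →
                  drop (toℕ i) (tabulate f) ≡ f i ∷ drop (suc (toℕ i)) (tabulate f)
  drop-tabulate f fzero = refl
  drop-tabulate f (fsuc i) = drop-tabulate (f ∘ fsuc) i

  drop-take-∷ : ∀ {t g} (xs : List A) {y zs} → t < g → drop t xs ≡ y ∷ zs →
                drop t (take g xs) ≡ y ∷ take (g ∸ suc t) zs
  drop-take-∷ {zero} {suc g} (x ∷ xs) _ refl = refl
  drop-take-∷ {suc t} {suc g} (x ∷ xs) (s≤s t<g) eq = drop-take-∷ xs t<g eq

  take-suc-∷ : ∀ t (xs : List A) {y zs} → drop t xs ≡ y ∷ zs → take (suc t) xs ≡ take t xs ++ [ y ]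
  take-suc-∷ zero (x ∷ xs) refl = refl
  take-suc-∷ (suc t) (x ∷ xs) eq = cong (x ∷_) (take-suc-∷ t xs eq)

  drop-++ : (xs ys : List A) (k : ℕ) → drop (length xs + k) (xs ++ ys) ≡ drop k ys
  drop-++ [] ys k = refl
  drop-++ (x ∷ xs) ys k = drop-++ xs ys k

  drop-++-≤ : (xs ys : List A) {k : ℕ} → k ≤ length xs → drop k (xs ++ ys) ≡ drop k xs ++ ys
  drop-++-≤ xs ys {zero} _ = refl
  drop-++-≤ (x ∷ xs) ys {suc k} (s≤s k≤) = drop-++-≤ xs ys k≤

  take-++-≤ : (xs ys : List A) {k : ℕ} → k ≤ length xs → take k (xs ++ ys) ≡ take k xs
  take-++-≤ xs ys {zero} _ = refl
  take-++-≤ (x ∷ xs) ys {suc k} (s≤s k≤) = cong (x ∷_) (take-++-≤ xs ys k≤)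

  take-length-++ : (xs ys : List A) → take (length xs) (xs ++ ys) ≡ xs
  take-length-++ [] ys = refl
  take-length-++ (x ∷ xs) ys = cong (x ∷_) (take-length-++ xs ys)

  ≤-length-drop : (xs : List A) {a k : ℕ} → a + k ≤ length xs → k ≤ length (drop a xs)
  ≤-length-drop xs {a} {k} a+k≤ =
    subst (k ≤_) (sym (length-drop a xs)) (subst (_≤ length xs ∸ a) (m+n∸m≡n a k) (∸-monoˡ-≤ a a+k≤))

  length-slice : (xs : List A) {a k : ℕ} → a + k ≤ length xs → length (take k (drop a xs)) ≡ k
  length-slice xs {a} {k} a+k≤ = trans (length-take k (drop a xs)) (m≤n⇒m⊓n≡m (≤-length-drop xs a+k≤))

  slice-++ : (xs ys zs : List A) {a k : ℕ} → a + k ≤ length ys →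
             take k (drop (length xs + a) (xs ++ ys ++ zs)) ≡ take k (drop a ys)
  slice-++ xs ys zs {a} {k} a+k≤ = begin
      take k (drop (length xs + a) (xs ++ ys ++ zs)) ≡⟨ cong (take k) (drop-++ xs (ys ++ zs) a) ⟩
      take k (drop a (ys ++ zs))                       ≡⟨ cong (take k) (drop-++-≤ ys zs (≤-trans (m≤m+n a k) a+k≤)) ⟩
      take k (drop a ys ++ zs)                         ≡⟨ take-++-≤ (drop a ys) zs (≤-length-drop ys a+k≤) ⟩
      take k (drop a ys)                               ∎
    where open ≡-Reasoning

  slice-reverse : (xs : List A) {a k : ℕ} → a + k ≤ length xs →
                  take k (drop (length xs ∸ (a + k)) (reverse xs)) ≡ reverse (take k (drop a xs))
  slice-reverse xs {a} {k} a+k≤ = begin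
      take k (drop (length xs ∸ (a + k)) (reverse xs))
        ≡⟨ cong₂ (λ j zs → take k (drop j zs)) length-ws reverse-split ⟩
      take k (drop (length (reverse ws) + 0) (reverse ws ++ reverse vs ++ reverse us))
        ≡⟨ cong (take k) (drop-++ (reverse ws) _ 0) ⟩
      take k (reverse vs ++ reverse us)
        ≡⟨ cong (λ j → take j (reverse vs ++ reverse us)) length-vs ⟩
      take (length (reverse vs)) (reverse vs ++ reverse us)
        ≡⟨ take-length-++ (reverse vs) (reverse us) ⟩
      reverse vs ∎
    where
      open ≡-Reasoning
      us = take a xs
      vs = take k (drop a xs)
      ws = drop k (drop a xs)
      reverse-split : reverse xs ≡ reverse ws ++ reverse vs ++ reverse us
      reverse-split = begin
        reverse xs                               ≡⟨ cong reverse (take++drop≡id a xs) ⟨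
        reverse (us ++ drop a xs)                ≡⟨ cong (reverse ∘ (us ++_)) (take++drop≡id k (drop a xs)) ⟨
        reverse (us ++ vs ++ ws)                 ≡⟨ reverse-++ us (vs ++ ws) ⟩
        reverse (vs ++ ws) ++ reverse us         ≡⟨ cong (_++ reverse us) (reverse-++ vs ws) ⟩
        (reverse ws ++ reverse vs) ++ reverse us ≡⟨ ++-assoc (reverse ws) (reverse vs) (reverse us) ⟩
        reverse ws ++ reverse vs ++ reverse us   ∎
      length-ws : length xs ∸ (a + k) ≡ length (reverse ws) + 0
      length-ws = sym (begin
        length (reverse ws) + 0   ≡⟨ +-identityʳ _ ⟩
        length (reverse ws)       ≡⟨ length-reverse ws ⟩
        length ws                 ≡⟨ length-drop k (drop a xs) ⟩
        length (drop a xs) ∸ k    ≡⟨ cong (_∸ k) (length-drop a xs) ⟩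
        length xs ∸ a ∸ k         ≡⟨ ∸-+-assoc (length xs) a k ⟩
        length xs ∸ (a + k)       ∎)
      length-vs : k ≡ length (reverse vs)
      length-vs = sym (trans (length-reverse vs) (length-slice xs a+k≤))

-- Subwords w[α, β]

[o∸n]∸[o∸m]≡m∸n : ∀ {m n o} → n ≤ m → m ≤ o → (o ∸ n) ∸ (o ∸ m) ≡ m ∸ n
[o∸n]∸[o∸m]≡m∸n z≤n m≤o = m∸[m∸n]≡n m≤o
[o∸n]∸[o∸m]≡m∸n (s≤s n≤m) (s≤s m≤o) = [o∸n]∸[o∸m]≡m∸n n≤m m≤o

[m+n]∸o∸m≡n∸o : ∀ m n o → (m + n) ∸ o ∸ m ≡ n ∸ o
[m+n]∸o∸m≡n∸o m n o = trans (∸-+-assoc (m + n) o m) (trans (cong ((m + n) ∸_) (+-comm o m)) ([m+n]∸[m+o]≡n∸o m n o))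

[m+n]∸[n∸o]≡m+o : ∀ m {n o} → o ≤ n → (m + n) ∸ (n ∸ o) ≡ m + o
[m+n]∸[n∸o]≡m+o m {n} {o} o≤n = trans (+-∸-assoc m (m∸n≤m n o)) (cong (m +_) (m∸[m∸n]≡n o≤n))

module Words {n : ℕ} (bar : Fin n → Fin n) (bar-involutive : ∀ a → bar (bar a) ≡ a) where

  Word : Set
  Word = List (Fin n)

  slice : Word → ℕ → ℕ → Word
  slice w a k = take k (drop a w)

  barW-involutive : ∀ w → barW bar (barW bar w) ≡ w
  barW-involutive w = begin
      reverse (map bar (reverse (map bar w))) ≡⟨ cong reverse (reverse-map bar (map bar w)) ⟩
      reverse (reverse (map bar (map bar w))) ≡⟨ reverse-involutive _ ⟩
      map bar (map bar w)                     ≡⟨ map-∘ w ⟨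
      map (bar ∘ bar) w                       ≡⟨ map-cong bar-involutive w ⟩
      map (λ a → a) w                         ≡⟨ map-id w ⟩
      w                                       ∎
    where open ≡-Reasoning

  length-barW : ∀ w → length (barW bar w) ≡ length w
  length-barW w = trans (length-reverse (map bar w)) (length-map bar w)

  slice-barW : ∀ w {a k} → a + k ≤ length w → slice (barW bar w) (length w ∸ (a + k)) k ≡ barW bar (slice w a k)
  slice-barW w {a} {k} a+k≤ = begin
      take k (drop (length w ∸ (a + k)) (reverse (map bar w)))
        ≡⟨ cong (λ j → take k (drop (j ∸ (a + k)) (reverse (map bar w)))) (length-map bar w) ⟨
      take k (drop (length (map bar w) ∸ (a + k)) (reverse (map bar w)))
        ≡⟨ slice-reverse (map bar w) (subst (a + k ≤_) (sym (length-map bar w)) a+k≤) ⟩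
      reverse (take k (drop a (map bar w)))
        ≡⟨ cong (reverse ∘ take k) (drop-map a w) ⟩
      reverse (take k (map bar (drop a w)))
        ≡⟨ cong reverse (take-map k (drop a w)) ⟩
      reverse (map bar (take k (drop a w))) ∎
    where open ≡-Reasoning

  sub-≤ : ∀ w {a b} → a ≤ b → sub bar w a b ≡ slice w a (b ∸ a)
  sub-≤ w {a} {b} a≤b with a ≤? b
  ... | yes _ = refl
  ... | no a≰b = ⊥-elim (a≰b a≤b)

  sub-≥ : ∀ w {a b} → b ≤ a → sub bar w a b ≡ barW bar (slice w b (a ∸ b))
  sub-≥ w {a} {b} b≤a with a ≤? b
  ... | no _ = refl
  ... | yes a≤b rewrite ≤-antisym a≤b b≤a | n∸n≡0 b = refl

  sub-swap : ∀ w a b → sub bar w b a ≡ barW bar (sub bar w a b)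
  sub-swap w a b with ≤-total a b
  ... | inj₁ a≤b = trans (sub-≥ w a≤b) (cong (barW bar) (sym (sub-≤ w a≤b)))
  ... | inj₂ b≤a = begin
      sub bar w b a                      ≡⟨ sub-≤ w b≤a ⟩
      slice w b (a ∸ b)                  ≡⟨ barW-involutive _ ⟨
      barW bar (barW bar (slice w b (a ∸ b))) ≡⟨ cong (barW bar) (sub-≥ w b≤a) ⟨
      barW bar (sub bar w a b)           ∎
    where open ≡-Reasoning

  sub-++-≤ : ∀ u v w {μ ν} → μ ≤ ν → ν ≤ length v →
             sub bar (u ++ v ++ w) (length u + μ) (length u + ν) ≡ sub bar v μ ν
  sub-++-≤ u v w {μ} {ν} μ≤ν ν≤ = begin
      sub bar (u ++ v ++ w) (length u + μ) (length u + ν)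
        ≡⟨ sub-≤ (u ++ v ++ w) (+-monoʳ-≤ (length u) μ≤ν) ⟩
      slice (u ++ v ++ w) (length u + μ) ((length u + ν) ∸ (length u + μ))
        ≡⟨ cong (slice (u ++ v ++ w) (length u + μ)) ([m+n]∸[m+o]≡n∸o (length u) ν μ) ⟩
      slice (u ++ v ++ w) (length u + μ) (ν ∸ μ)
        ≡⟨ slice-++ u v w (subst (_≤ length v) (sym (m+[n∸m]≡n μ≤ν)) ν≤) ⟩
      slice v μ (ν ∸ μ)
        ≡⟨ sub-≤ v μ≤ν ⟨
      sub bar v μ ν ∎
    where open ≡-Reasoning

  sub-++ : ∀ u v w {μ ν} → μ ≤ length v → ν ≤ length v →
           sub bar (u ++ v ++ w) (length u + μ) (length u + ν) ≡ sub bar v μ ν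
  sub-++ u v w {μ} {ν} μ≤ ν≤ with ≤-total μ ν
  ... | inj₁ μ≤ν = sub-++-≤ u v w μ≤ν ν≤
  ... | inj₂ ν≤μ = begin
      sub bar (u ++ v ++ w) (length u + μ) (length u + ν)
        ≡⟨ sub-swap (u ++ v ++ w) (length u + ν) (length u + μ) ⟩
      barW bar (sub bar (u ++ v ++ w) (length u + ν) (length u + μ))
        ≡⟨ cong (barW bar) (sub-++-≤ u v w ν≤μ μ≤) ⟩
      barW bar (sub bar v ν μ)
        ≡⟨ sub-swap v ν μ ⟨
      sub bar v μ ν ∎
    where open ≡-Reasoning

  sub-barW-≥ : ∀ w {μ ν} → ν ≤ μ → μ ≤ length w →
               sub bar (barW bar w) (length w ∸ μ) (length w ∸ ν) ≡ sub bar w μ ν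
  sub-barW-≥ w {μ} {ν} ν≤μ μ≤ = begin
      sub bar (barW bar w) (length w ∸ μ) (length w ∸ ν)
        ≡⟨ sub-≤ (barW bar w) (∸-monoʳ-≤ (length w) ν≤μ) ⟩
      slice (barW bar w) (length w ∸ μ) ((length w ∸ ν) ∸ (length w ∸ μ))
        ≡⟨ cong (slice (barW bar w) (length w ∸ μ)) ([o∸n]∸[o∸m]≡m∸n ν≤μ μ≤) ⟩
      slice (barW bar w) (length w ∸ μ) (μ ∸ ν)
        ≡⟨ cong (λ j → slice (barW bar w) (length w ∸ j) (μ ∸ ν)) (m+[n∸m]≡n ν≤μ) ⟨
      slice (barW bar w) (length w ∸ (ν + (μ ∸ ν))) (μ ∸ ν)
        ≡⟨ slice-barW w (subst (_≤ length w) (sym (m+[n∸m]≡n ν≤μ)) μ≤) ⟩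
      barW bar (slice w ν (μ ∸ ν))
        ≡⟨ sub-≥ w ν≤μ ⟨
      sub bar w μ ν ∎
    where open ≡-Reasoning

  sub-barW : ∀ w {μ ν} → μ ≤ length w → ν ≤ length w →
             sub bar (barW bar w) (length w ∸ μ) (length w ∸ ν) ≡ sub bar w μ ν
  sub-barW w {μ} {ν} μ≤ ν≤ with ≤-total ν μ
  ... | inj₁ ν≤μ = sub-barW-≥ w ν≤μ μ≤
  ... | inj₂ μ≤ν = begin
      sub bar (barW bar w) (length w ∸ μ) (length w ∸ ν)
        ≡⟨ sub-swap (barW bar w) (length w ∸ ν) (length w ∸ μ) ⟩
      barW bar (sub bar (barW bar w) (length w ∸ ν) (length w ∸ μ))
        ≡⟨ cong (barW bar) (sub-barW-≥ w μ≤ν ν≤) ⟩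
      barW bar (sub bar w ν μ)
        ≡⟨ sub-swap w ν μ ⟨
      sub bar w μ ν ∎
    where open ≡-Reasoning

  length-sub : ∀ w {a b} → a ≤ length w → b ≤ length w → length (sub bar w a b) ≡ ∣ a - b ∣
  length-sub w {a} {b} a≤ b≤ with ≤-total a b
  ... | inj₁ a≤b = begin
      length (sub bar w a b)   ≡⟨ cong length (sub-≤ w a≤b) ⟩
      length (slice w a (b ∸ a)) ≡⟨ length-slice w (subst (_≤ length w) (sym (m+[n∸m]≡n a≤b)) b≤) ⟩
      b ∸ a                    ≡⟨ m≤n⇒∣m-n∣≡n∸m a≤b ⟨
      ∣ a - b ∣                ∎
    where open ≡-Reasoning
  ... | inj₂ b≤a = begin
      length (sub bar w a b)                ≡⟨ cong length (sub-≥ w b≤a) ⟩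
      length (barW bar (slice w b (a ∸ b))) ≡⟨ length-barW (slice w b (a ∸ b)) ⟩
      length (slice w b (a ∸ b))            ≡⟨ length-slice w (subst (_≤ length w) (sym (m+[n∸m]≡n b≤a)) a≤) ⟩
      a ∸ b                                 ≡⟨ m≤n⇒∣n-m∣≡n∸m b≤a ⟨
      ∣ a - b ∣                             ∎
    where open ≡-Reasoning

  sub-≢[] : ∀ w {a b} → a ≤ length w → b ≤ length w → a ≢ b → sub bar w a b ≢ []
  sub-≢[] w a≤ b≤ a≢b eq = a≢b (∣m-n∣≡0⇒m≡n (trans (sym (length-sub w a≤ b≤)) (cong length eq)))

-- Finite searches

module _ {A : Set} where

  count : {P : A → Set} → (∀ a → Dec (P a)) → List A → ℕ
  count P? [] = 0
  count P? (a ∷ as) with P? a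
  ... | yes _ = suc (count P? as)
  ... | no _ = count P? as

  count≤length : {P : A → Set} (P? : ∀ a → Dec (P a)) (as : List A) → count P? as ≤ length as
  count≤length P? [] = z≤n
  count≤length P? (a ∷ as) with P? a
  ... | yes _ = s≤s (count≤length P? as)
  ... | no _ = m≤n⇒m≤1+n (count≤length P? as)

  module _ {P Q : A → Set} (P? : ∀ a → Dec (P a)) (Q? : ∀ a → Dec (Q a)) (P⇒Q : ∀ {a} → P a → Q a) where

    count-mono : (as : List A) → count P? as ≤ count Q? as
    count-mono [] = z≤n
    count-mono (a ∷ as) with P? a | Q? a
    ... | yes _ | yes _ = s≤s (count-mono as)
    ... | yes p | no ¬q = ⊥-elim (¬q (P⇒Q p))
    ... | no _ | yes _ = m≤n⇒m≤1+n (count-mono as)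
    ... | no _ | no _ = count-mono as

    count-mono-< : (as : List A) → Any (λ a → Q a × ¬ P a) as → count P? as < count Q? as
    count-mono-< (a ∷ as) (here (q , ¬p)) with P? a | Q? a
    ... | yes p | _ = ⊥-elim (¬p p)
    ... | no _ | yes _ = s≤s (count-mono as)
    ... | no _ | no ¬q = ⊥-elim (¬q q)
    count-mono-< (a ∷ as) (there any) with P? a | Q? a
    ... | yes _ | yes _ = s≤s (count-mono-< as any)
    ... | yes p | no ¬q = ⊥-elim (¬q (P⇒Q p))
    ... | no _ | yes _ = m≤n⇒m≤1+n (count-mono-< as any)
    ... | no _ | no _ = count-mono-< as any

module FiniteReachability {A : Set} (_≟_ : DecidableEquality A)
  {_⟶_ : A → A → Set} (_⟶?_ : ∀ u v → Dec (u ⟶ v))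
  (U : List A) (⟶-∈ : ∀ {u v} → u ⟶ v → v ∈ U)
  (s : A) (s∈U : s ∈ U) where

  ReachableWithin : ℕ → A → Set
  ReachableWithin zero t = s ≡ t
  ReachableWithin (suc k) t = ReachableWithin k t ⊎ Any (λ u → ReachableWithin k u × u ⟶ t) U

  reachableWithin? : ∀ k t → Dec (ReachableWithin k t)
  reachableWithin? zero t = s ≟ t
  reachableWithin? (suc k) t = reachableWithin? k t ⊎-dec any? (λ u → reachableWithin? k u ×-dec (u ⟶? t)) U

  within-∈ : ∀ k {t} → ReachableWithin k t → t ∈ U
  within-∈ zero refl = s∈U
  within-∈ (suc k) (inj₁ w) = within-∈ k w
  within-∈ (suc k) (inj₂ any) = ⟶-∈ (proj₂ (proj₂ (Any.satisfied any)))

  within⇒star : ∀ k {t} → ReachableWithin k t → Star _⟶_ s t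
  within⇒star zero refl = ε
  within⇒star (suc k) (inj₁ w) = within⇒star k w
  within⇒star (suc k) (inj₂ any) with Any.satisfied any
  ... | u , w , u⟶t = within⇒star k w ◅◅ (u⟶t ◅ ε)

  within-start : ∀ k → ReachableWithin k s
  within-start zero = refl
  within-start (suc k) = inj₁ (within-start k)

  Closed : ℕ → Set
  Closed k = ∀ {u t} → ReachableWithin k u → u ⟶ t → ReachableWithin k t

  closed-suc : ∀ {k} → Closed k → Closed (suc k)
  closed-suc {k} closed w u⟶t = inj₁ (closed (shrink w) u⟶t)
    where
      shrink : ∀ {u} → ReachableWithin (suc k) u → ReachableWithin k u
      shrink (inj₁ w) = w
      shrink (inj₂ any) with Any.satisfied any
      ... | _ , w , u⟶t = closed w u⟶t

  -- Until the k-step reachable set is closed under ⟶, it gains a vertex of U at every step.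
  closed⊎growing : ∀ k → Closed k ⊎ k ≤ count (reachableWithin? k) U
  closed⊎growing zero = inj₂ z≤n
  closed⊎growing (suc k) with closed⊎growing k
  ... | inj₁ closed = inj₁ (closed-suc closed)
  ... | inj₂ k≤count with all? (λ t → reachableWithin? (suc k) t →-dec reachableWithin? k t) U
  ...   | yes stable = inj₁ (closed-suc closed)
    where
      closed : Closed k
      closed w u⟶t = All.lookup stable (⟶-∈ u⟶t) (inj₂ (Any.map (λ { refl → w , u⟶t }) (within-∈ k w)))
  ...   | no ¬stable = inj₂ (≤-trans (s≤s k≤count)
            (count-mono-< (reachableWithin? k) (reachableWithin? (suc k)) inj₁ U
              (Any.map new (¬All⇒Any¬ (λ t → reachableWithin? (suc k) t →-dec reachableWithin? k t) U ¬stable))))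
    where
      new : ∀ {t} → ¬ (ReachableWithin (suc k) t → ReachableWithin k t) → ReachableWithin (suc k) t × ¬ ReachableWithin k t
      new {t} ¬imp with reachableWithin? (suc k) t
      ... | yes w = w , λ w′ → ¬imp (λ _ → w′)
      ... | no ¬w = ⊥-elim (¬imp (⊥-elim ∘ ¬w))

  K : ℕ
  K = suc (length U)

  closed-K : Closed K
  closed-K with closed⊎growing K
  ... | inj₁ closed = closed
  ... | inj₂ K≤count = ⊥-elim (<⇒≱ (s≤s (count≤length (reachableWithin? K) U)) K≤count)

  star⇒within : ∀ {t} → Star _⟶_ s t → ReachableWithin K t
  star⇒within = go (within-start K)
    where
      go : ∀ {u t} → ReachableWithin K u → Star _⟶_ u t → ReachableWithin K t
      go w ε = w
      go w (u⟶v ◅ path) = go (closed-K w u⟶v) path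

  ∀-reachable? : {P : A → Set} → (∀ t → Dec (P t)) → Dec (∀ t → Star _⟶_ s t → P t)
  ∀-reachable? {P} P? with all? (λ t → reachableWithin? K t →-dec P? t) U
  ... | yes all = yes λ t path → All.lookup all (within-∈ K (star⇒within path)) (star⇒within path)
  ... | no ¬all with Any.satisfied (¬All⇒Any¬ (λ t → reachableWithin? K t →-dec P? t) U ¬all)
  ...   | t , ¬imp with reachableWithin? K t | P? t
  ...     | _ | yes p = ⊥-elim (¬imp (λ _ → p))
  ...     | yes w | no ¬p = no λ all → ¬p (all t (within⇒star K w))
  ...     | no ¬w | no _ = ⊥-elim (¬imp (⊥-elim ∘ ¬w))

module _ {P : ℕ → Set} (P? : ∀ t → Dec (P t)) where

  greatest : ℕ → ℕ
  greatest zero = 0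
  greatest (suc k) with P? (suc k)
  ... | yes _ = suc k
  ... | no _ = greatest k

  greatest≤ : ∀ k → greatest k ≤ k
  greatest≤ zero = z≤n
  greatest≤ (suc k) with P? (suc k)
  ... | yes _ = ≤-refl
  ... | no _ = m≤n⇒m≤1+n (greatest≤ k)

  ≤greatest : ∀ {t} k → P t → t ≤ k → t ≤ greatest k
  ≤greatest zero _ t≤0 = t≤0
  ≤greatest {t} (suc k) p t≤ with P? (suc k)
  ... | yes _ = t≤
  ... | no ¬p with m≤n⇒m<n∨m≡n t≤
  ...   | inj₁ t<1+k = ≤greatest k p (≤-pred t<1+k)
  ...   | inj₂ refl = ⊥-elim (¬p p)

  greatest-satisfies : ∀ k → 0 < greatest k → P (greatest k)
  greatest-satisfies (suc k) pos with P? (suc k)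
  ... | yes p = p
  ... | no _ = greatest-satisfies k pos

-- Betweenness and monotone maps

Between : ℕ → ℕ → ℕ → Set
Between y a b = (a ≤ y × y ≤ b) ⊎ (b ≤ y × y ≤ a)

StrictlyBetween : ℕ → ℕ → ℕ → Set
StrictlyBetween y a b = (a < y × y < b) ⊎ (b < y × y < a)

StepAway : ℕ → ℕ → ℕ → Set
StepAway a′ a b = (suc a′ ≡ a × a < b) ⊎ (a′ ≡ suc a × b < a)

Adjacent : ℕ → ℕ → Set
Adjacent a b = suc a ≡ b ⊎ a ≡ suc b

strictlyBetween? : ∀ y a b → Dec (StrictlyBetween y a b)
strictlyBetween? y a b = (a <? y ×-dec y <? b) ⊎-dec (b <? y ×-dec y <? a)

strictlyBetween-swap : ∀ {y a b} → StrictlyBetween y a b → StrictlyBetween y b a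
strictlyBetween-swap (inj₁ y∈) = inj₂ y∈
strictlyBetween-swap (inj₂ y∈) = inj₁ y∈

strictlyBetween⇒between : ∀ {y a b} → StrictlyBetween y a b → Between y a b
strictlyBetween⇒between (inj₁ (a<y , y<b)) = inj₁ (<⇒≤ a<y , <⇒≤ y<b)
strictlyBetween⇒between (inj₂ (b<y , y<a)) = inj₂ (<⇒≤ b<y , <⇒≤ y<a)

strictlyBetween⇒⊓<×<⊔ : ∀ {y a b} → StrictlyBetween y a b → a ⊓ b < y × y < a ⊔ b
strictlyBetween⇒⊓<×<⊔ {y} (inj₁ (a<y , y<b)) = let a≤b = <⇒≤ (<-trans a<y y<b) in
  subst (_< y) (sym (m≤n⇒m⊓n≡m a≤b)) a<y , subst (y <_) (sym (m≤n⇒m⊔n≡n a≤b)) y<b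
strictlyBetween⇒⊓<×<⊔ {y} (inj₂ (b<y , y<a)) = let b≤a = <⇒≤ (<-trans b<y y<a) in
  subst (_< y) (sym (m≥n⇒m⊓n≡n b≤a)) b<y , subst (y <_) (sym (m≥n⇒m⊔n≡m b≤a)) y<a

⊓<×<⊔⇒strictlyBetween : ∀ {y a b} → a ⊓ b < y × y < a ⊔ b → StrictlyBetween y a b
⊓<×<⊔⇒strictlyBetween {y} {a} {b} (lo<y , y<hi) with ≤-total a b
... | inj₁ a≤b = inj₁ (subst (_< y) (m≤n⇒m⊓n≡m a≤b) lo<y , subst (y <_) (m≤n⇒m⊔n≡n a≤b) y<hi)
... | inj₂ b≤a = inj₂ (subst (_< y) (m≥n⇒m⊓n≡n b≤a) lo<y , subst (y <_) (m≥n⇒m⊔n≡m b≤a) y<hi)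

between-convex : ∀ {L R y a b} → L ≤ a × a ≤ R → L ≤ b × b ≤ R → Between y a b → L ≤ y × y ≤ R
between-convex (L≤a , _) (_ , b≤R) (inj₁ (a≤y , y≤b)) = ≤-trans L≤a a≤y , ≤-trans y≤b b≤R
between-convex (_ , a≤R) (L≤b , _) (inj₂ (b≤y , y≤a)) = ≤-trans L≤b b≤y , ≤-trans y≤a a≤R

stepAway⇒between : ∀ {a′ a b} → StepAway a′ a b → Between a a′ b
stepAway⇒between (inj₁ (refl , a<b)) = inj₁ (n≤1+n _ , <⇒≤ a<b)
stepAway⇒between (inj₂ (refl , b<a)) = inj₂ (<⇒≤ b<a , n≤1+n _)

stepAway-strictlyBetween : ∀ {y a′ a b} → StepAway a′ a b → StrictlyBetween y a′ b →
                           StrictlyBetween y a b ⊎ y ≡ a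
stepAway-strictlyBetween (inj₁ (refl , _)) (inj₁ (a′<y , y<b)) with m≤n⇒m<n∨m≡n a′<y
... | inj₁ a<y = inj₁ (inj₁ (a<y , y<b))
... | inj₂ a≡y = inj₂ (sym a≡y)
stepAway-strictlyBetween (inj₁ (refl , a<b)) (inj₂ (b<y , y<a′)) =
  ⊥-elim (<-asym a<b (<-trans b<y (<-trans y<a′ (n<1+n _))))
stepAway-strictlyBetween (inj₂ (refl , b<a)) (inj₁ (a′<y , y<b)) =
  ⊥-elim (<-asym b<a (<-trans (n<1+n _) (<-trans a′<y y<b)))
stepAway-strictlyBetween (inj₂ (refl , _)) (inj₂ (b<y , y<a′)) with m≤n⇒m<n∨m≡n (≤-pred y<a′)
... | inj₁ y<a = inj₁ (inj₂ (b<y , y<a))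
... | inj₂ y≡a = inj₂ y≡a

adjacent⇒¬strictlyBetween : ∀ {y a b} → Adjacent a b → ¬ StrictlyBetween y a b
adjacent⇒¬strictlyBetween (inj₁ refl) (inj₁ (a<y , y<b)) = <-irrefl refl (<-≤-trans a<y (≤-pred y<b))
adjacent⇒¬strictlyBetween (inj₁ refl) (inj₂ (b<y , y<a)) = <-asym b<y (<-trans y<a (n<1+n _))
adjacent⇒¬strictlyBetween (inj₂ refl) (inj₁ (a<y , y<b)) = <-asym a<y (<-trans y<b (n<1+n _))
adjacent⇒¬strictlyBetween (inj₂ refl) (inj₂ (b<y , y<a)) = <-irrefl refl (<-≤-trans b<y (≤-pred y<a))

between⇒⊓≤×≤⊔ : ∀ {y a b} → Between y a b → a ⊓ b ≤ y × y ≤ a ⊔ b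
between⇒⊓≤×≤⊔ {a = a} {b} (inj₁ (a≤y , y≤b)) = ≤-trans (m⊓n≤m a b) a≤y , ≤-trans y≤b (m≤n⊔m a b)
between⇒⊓≤×≤⊔ {a = a} {b} (inj₂ (b≤y , y≤a)) = ≤-trans (m⊓n≤n a b) b≤y , ≤-trans y≤a (m≤m⊔n a b)

covers⊎splits : ∀ {L R A B a b} → Between a A B → Between b A B → a ≢ b →
                L ≤ a × a ≤ R → L ≤ b × b ≤ R →
                (L ≤ A × A ≤ R) × (L ≤ B × B ≤ R) ⊎ (StrictlyBetween L A B ⊎ StrictlyBetween R A B)
covers⊎splits {L} {R} {A} {B} {a} {b} a∈ b∈ a≢b a∈LR b∈LR with L ≤? (A ⊓ B) | (A ⊔ B) ≤? R
... | yes L≤lo | yes hi≤R = inj₁ ((≤-trans L≤lo (m⊓n≤m A B) , ≤-trans (m≤m⊔n A B) hi≤R) ,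
                                  (≤-trans L≤lo (m⊓n≤n A B) , ≤-trans (m≤n⊔m A B) hi≤R))
... | no L≰lo | _ = inj₂ (inj₁ (⊓<×<⊔⇒strictlyBetween (≰⇒> L≰lo , L<hi)))
  where
    L<hi : L < A ⊔ B
    L<hi with L <? (A ⊔ B)
    ... | yes L<hi = L<hi
    ... | no L≮hi = ⊥-elim (a≢b (trans (pinned a∈ (proj₁ a∈LR)) (sym (pinned b∈ (proj₁ b∈LR)))))
      where
        pinned : ∀ {y} → Between y A B → L ≤ y → y ≡ L
        pinned y∈ L≤y = ≤-antisym (≤-trans (proj₂ (between⇒⊓≤×≤⊔ y∈)) (≮⇒≥ L≮hi)) L≤y
... | yes _ | no hi≰R = inj₂ (inj₂ (⊓<×<⊔⇒strictlyBetween (lo<R , ≰⇒> hi≰R)))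
  where
    lo<R : A ⊓ B < R
    lo<R with (A ⊓ B) <? R
    ... | yes lo<R = lo<R
    ... | no lo≮R = ⊥-elim (a≢b (trans (pinned a∈ (proj₂ a∈LR)) (sym (pinned b∈ (proj₂ b∈LR)))))
      where
        pinned : ∀ {y} → Between y A B → y ≤ R → y ≡ R
        pinned y∈ y≤R = ≤-antisym y≤R (≤-trans (≮⇒≥ lo≮R) (proj₁ (between⇒⊓≤×≤⊔ y∈)))

record IncreasingOn (B : ℕ → Set) (f : ℕ → ℕ) : Set where
  field
    mono-≤ : ∀ {a b} → B a → B b → a ≤ b → f a ≤ f b
    mono-< : ∀ {a b} → B a → B b → a < b → f a < f b
    suc-commute : ∀ {a b} → B a → B b → suc a ≡ b → suc (f a) ≡ f b

record DecreasingOn (B : ℕ → Set) (f : ℕ → ℕ) : Set where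
  field
    anti-≤ : ∀ {a b} → B a → B b → a ≤ b → f b ≤ f a
    anti-< : ∀ {a b} → B a → B b → a < b → f b < f a
    suc-reflect : ∀ {a b} → B a → B b → suc a ≡ b → suc (f b) ≡ f a

MonotoneOn : (ℕ → Set) → (ℕ → ℕ) → Set
MonotoneOn B f = IncreasingOn B f ⊎ DecreasingOn B f

module _ {B : ℕ → Set} {f : ℕ → ℕ} where
  open IncreasingOn
  open DecreasingOn

  between-preserved : MonotoneOn B f → ∀ {y a b} → B y → B a → B b → Between y a b → Between (f y) (f a) (f b)
  between-preserved (inj₁ inc) y∈ a∈ b∈ (inj₁ (a≤y , y≤b)) = inj₁ (mono-≤ inc a∈ y∈ a≤y , mono-≤ inc y∈ b∈ y≤b)
  between-preserved (inj₁ inc) y∈ a∈ b∈ (inj₂ (b≤y , y≤a)) = inj₂ (mono-≤ inc b∈ y∈ b≤y , mono-≤ inc y∈ a∈ y≤a)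
  between-preserved (inj₂ dec) y∈ a∈ b∈ (inj₁ (a≤y , y≤b)) = inj₂ (anti-≤ dec y∈ b∈ y≤b , anti-≤ dec a∈ y∈ a≤y)
  between-preserved (inj₂ dec) y∈ a∈ b∈ (inj₂ (b≤y , y≤a)) = inj₁ (anti-≤ dec y∈ a∈ y≤a , anti-≤ dec b∈ y∈ b≤y)

  strictlyBetween-preserved : MonotoneOn B f → ∀ {y a b} → B y → B a → B b →
                              StrictlyBetween y a b → StrictlyBetween (f y) (f a) (f b)
  strictlyBetween-preserved (inj₁ inc) y∈ a∈ b∈ (inj₁ (a<y , y<b)) = inj₁ (mono-< inc a∈ y∈ a<y , mono-< inc y∈ b∈ y<b)
  strictlyBetween-preserved (inj₁ inc) y∈ a∈ b∈ (inj₂ (b<y , y<a)) = inj₂ (mono-< inc b∈ y∈ b<y , mono-< inc y∈ a∈ y<a)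
  strictlyBetween-preserved (inj₂ dec) y∈ a∈ b∈ (inj₁ (a<y , y<b)) = inj₂ (anti-< dec y∈ b∈ y<b , anti-< dec a∈ y∈ a<y)
  strictlyBetween-preserved (inj₂ dec) y∈ a∈ b∈ (inj₂ (b<y , y<a)) = inj₁ (anti-< dec y∈ a∈ y<a , anti-< dec b∈ y∈ b<y)

  stepAway-preserved : MonotoneOn B f → ∀ {a′ a b} → B a′ → B a → B b → StepAway a′ a b → StepAway (f a′) (f a) (f b)
  stepAway-preserved (inj₁ inc) a′∈ a∈ b∈ (inj₁ (eq , a<b)) = inj₁ (suc-commute inc a′∈ a∈ eq , mono-< inc a∈ b∈ a<b)
  stepAway-preserved (inj₁ inc) a′∈ a∈ b∈ (inj₂ (eq , b<a)) =
    inj₂ (sym (suc-commute inc a∈ a′∈ (sym eq)) , mono-< inc b∈ a∈ b<a)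
  stepAway-preserved (inj₂ dec) a′∈ a∈ b∈ (inj₁ (eq , a<b)) =
    inj₂ (sym (suc-reflect dec a′∈ a∈ eq) , anti-< dec a∈ b∈ a<b)
  stepAway-preserved (inj₂ dec) a′∈ a∈ b∈ (inj₂ (eq , b<a)) =
    inj₁ (suc-reflect dec a∈ a′∈ (sym eq) , anti-< dec b∈ a∈ b<a)

  adjacent-preserved : MonotoneOn B f → ∀ {a b} → B a → B b → Adjacent a b → Adjacent (f a) (f b)
  adjacent-preserved (inj₁ inc) a∈ b∈ (inj₁ eq) = inj₁ (suc-commute inc a∈ b∈ eq)
  adjacent-preserved (inj₁ inc) a∈ b∈ (inj₂ eq) = inj₂ (sym (suc-commute inc b∈ a∈ (sym eq)))
  adjacent-preserved (inj₂ dec) a∈ b∈ (inj₁ eq) = inj₂ (sym (suc-reflect dec a∈ b∈ eq))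
  adjacent-preserved (inj₂ dec) a∈ b∈ (inj₂ eq) = inj₁ (suc-reflect dec b∈ a∈ (sym eq))

  <⇒image-≢ : MonotoneOn B f → ∀ {a b} → B a → B b → a < b → f a ≢ f b
  <⇒image-≢ (inj₁ inc) a∈ b∈ a<b = <⇒≢ (mono-< inc a∈ b∈ a<b)
  <⇒image-≢ (inj₂ dec) a∈ b∈ a<b = ≢-sym (<⇒≢ (anti-< dec a∈ b∈ a<b))

  ≢-preserved : MonotoneOn B f → ∀ {a b} → B a → B b → a ≢ b → f a ≢ f b
  ≢-preserved mono {a} {b} a∈ b∈ a≢b with <-cmp a b
  ... | tri< a<b _ _ = <⇒image-≢ mono a∈ b∈ a<b
  ... | tri≈ _ a≡b _ = ⊥-elim (a≢b a≡b)
  ... | tri> _ _ b<a = ≢-sym (<⇒image-≢ mono b∈ a∈ b<a)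

-- Block positions

offset : {A : Set} → List (List A) → ℕ → ℕ
offset ys t = length (concat (take t ys))

sum-take-map-length : {A : Set} (t : ℕ) (ys : List (List A)) → sum (take t (map length ys)) ≡ offset ys t
sum-take-map-length t ys = trans (cong sum (take-map t ys)) (sym (length-concat (take t ys)))

offset-all : {A : Set} (ys : List (List A)) {t : ℕ} → length ys ≤ t → offset ys t ≡ length (concat ys)
offset-all ys {t} ys≤t = cong (length ∘ concat) (take-all t ys ys≤t)

module _ {A : Set} (ys : List (List A)) (t : ℕ) {y : List A} {zs : List (List A)} (drop≡ : drop t ys ≡ y ∷ zs) where
  open ≡-Reasoning

  concat-split : concat ys ≡ concat (take t ys) ++ y ++ concat zs
  concat-split = begin
    concat ys                                ≡⟨ cong concat (take++drop≡id t ys) ⟨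
    concat (take t ys ++ drop t ys)          ≡⟨ concat-++ (take t ys) (drop t ys) ⟨
    concat (take t ys) ++ concat (drop t ys) ≡⟨ cong (λ v → concat (take t ys) ++ concat v) drop≡ ⟩
    concat (take t ys) ++ y ++ concat zs     ∎

  offset-suc : offset ys t + length y ≡ offset ys (suc t)
  offset-suc = begin
    length (concat (take t ys)) + length y       ≡⟨ length-++ (concat (take t ys)) ⟨
    length (concat (take t ys) ++ y)             ≡⟨ cong (λ v → length (concat (take t ys) ++ v)) (++-identityʳ y) ⟨
    length (concat (take t ys) ++ concat [ y ])  ≡⟨ cong length (concat-++ (take t ys) [ y ]) ⟩
    length (concat (take t ys ++ [ y ]))         ≡⟨ cong (length ∘ concat) (take-suc-∷ t ys drop≡) ⟨
    offset ys (suc t)                            ∎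

-- The variables are x₀, …, x_d here, so the d of the paper is suc d.
module FreeIntervals {n k : ℕ}
  (barΓ : Fin n → Fin n) (barΓ-involutive : ∀ a → barΓ (barΓ a) ≡ a)
  (barΩ : Fin k → Fin k) (barΩ-involutive : ∀ X → barΩ (barΩ X) ≡ X)
  (σ : Fin k → List (Fin n)) (σ-bar : ∀ X → σ (barΩ X) ≡ barW barΓ (σ X))
  {d : ℕ} (x : Fin (suc d) → Fin n ⊎ Fin k) (g : ℕ) (2≤g : 2 ≤ g) (g≤d : g ≤ d)
  (w₀ : List (Fin n))
  (left≡w₀ : Setting.leftWord barΓ barΩ σ x g ≡ w₀)
  (right≡w₀ : Setting.rightWord barΓ barΩ σ x g ≡ w₀)
  (σx≢[] : ∀ i → Setting.σL barΓ barΩ σ x g (x i) ≢ [])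
  where

  open Setting barΓ barΩ σ x g
  open Words barΓ barΓ-involutive
  open DecMembership (≡-dec (_≟ᶠ_ {n})) using (_∈?_)

  m : ℕ
  m = length w₀

  l-left : ∀ i → toℕ i < g → l i ≡ offset (take g σx) (toℕ i)
  l-left i i<g with suc (toℕ i) ≤? g
  ... | no i≮g = ⊥-elim (i≮g i<g)
  ... | yes _ = begin
      sum (take (toℕ i) lens)                  ≡⟨ sum-take-map-length (toℕ i) σx ⟩
      offset σx (toℕ i)                        ≡⟨ cong (offset σx) (m≤n⇒m⊓n≡m (<⇒≤ i<g)) ⟨
      offset σx (toℕ i ⊓ g)                    ≡⟨ cong (length ∘ concat) (take-take (toℕ i) g σx) ⟨
      offset (take g σx) (toℕ i)               ∎
    where open ≡-Reasoning

  l-right : ∀ i → g ≤ toℕ i → l i ≡ offset (drop g σx) (toℕ i ∸ g)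
  l-right i g≤i with suc (toℕ i) ≤? g
  ... | yes i<g = ⊥-elim (<⇒≱ i<g g≤i)
  ... | no _ = trans (cong (sum ∘ take (toℕ i ∸ g)) (drop-map g σx)) (sum-take-map-length (toℕ i ∸ g) (drop g σx))

  drop-σx : ∀ i → drop (toℕ i) σx ≡ σL (x i) ∷ drop (suc (toℕ i)) σx
  drop-σx = drop-tabulate (σL ∘ x)

  row-left : ∀ i → toℕ i < g → drop (toℕ i) (take g σx) ≡ σL (x i) ∷ take (g ∸ suc (toℕ i)) (drop (suc (toℕ i)) σx)
  row-left i i<g = drop-take-∷ σx i<g (drop-σx i)

  row-right : ∀ i → g ≤ toℕ i → drop (toℕ i ∸ g) (drop g σx) ≡ σL (x i) ∷ drop (suc (toℕ i)) σx
  row-right i g≤i = trans (drop-drop g (toℕ i ∸ g) σx) (trans (cong (λ t → drop t σx) (m+[n∸m]≡n g≤i)) (drop-σx i))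

  r-left : ∀ i → toℕ i < g → r i ≡ offset (take g σx) (suc (toℕ i))
  r-left i i<g = trans (cong (_+ len i) (l-left i i<g)) (offset-suc (take g σx) (toℕ i) (row-left i i<g))

  r-right : ∀ i → g ≤ toℕ i → r i ≡ offset (drop g σx) (suc (toℕ i ∸ g))
  r-right i g≤i = trans (cong (_+ len i) (l-right i g≤i)) (offset-suc (drop g σx) (toℕ i ∸ g) (row-right i g≤i))

  l≡0-first : ∀ i → toℕ i ≡ 0 → l i ≡ 0
  l≡0-first i i≡0 = trans (l-left i (subst (_< g) (sym i≡0) (≤-trans (s≤s z≤n) 2≤g))) (cong (offset (take g σx)) i≡0)

  l≡0-middle : ∀ i → toℕ i ≡ g → l i ≡ 0
  l≡0-middle i i≡g =
    trans (l-right i (≤-reflexive (sym i≡g))) (cong (offset (drop g σx)) (trans (cong (_∸ g) i≡g) (n∸n≡0 g)))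

  r≡l-next : ∀ i j → toℕ j ≡ suc (toℕ i) → toℕ j ≢ g → r i ≡ l j
  r≡l-next i j j≡1+i j≢g with <-≤-connex (toℕ i) g
  ... | inj₁ i<g = trans (r-left i i<g)
                    (trans (cong (offset (take g σx)) (sym j≡1+i)) (sym (l-left j (≤∧≢⇒< (subst (_≤ g) (sym j≡1+i) i<g) j≢g))))
  ... | inj₂ g≤i = trans (r-right i g≤i)
                     (trans (cong (offset (drop g σx)) (trans (sym (+-∸-assoc 1 g≤i)) (cong (_∸ g) (sym j≡1+i))))
                       (sym (l-right j (subst (g ≤_) (sym j≡1+i) (m≤n⇒m≤1+n g≤i)))))

  r≡m-middle : ∀ i → suc (toℕ i) ≡ g → r i ≡ m
  r≡m-middle i 1+i≡g = begin
      r i                        ≡⟨ r-left i (subst (toℕ i <_) 1+i≡g ≤-refl) ⟩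
      offset (take g σx) (suc (toℕ i)) ≡⟨ cong (offset (take g σx)) 1+i≡g ⟩
      offset (take g σx) g       ≡⟨ offset-all (take g σx) (subst (_≤ g) (sym (length-take g σx)) (m⊓n≤m g _)) ⟩
      length leftWord            ≡⟨ cong length left≡w₀ ⟩
      m                          ∎
    where open ≡-Reasoning

  r≡m-last : ∀ i → suc (toℕ i) ≡ suc d → r i ≡ m
  r≡m-last i 1+i≡1+d = begin
      r i                                      ≡⟨ r-right i g≤i ⟩
      offset (drop g σx) (suc (toℕ i ∸ g))     ≡⟨ offset-all (drop g σx) length≤ ⟩
      length rightWord                         ≡⟨ cong length right≡w₀ ⟩
      m                                        ∎
    where
      open ≡-Reasoning
      g≤i : g ≤ toℕ i
      g≤i = subst (g ≤_) (suc-injective (sym 1+i≡1+d)) g≤d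
      length≤ : length (drop g σx) ≤ suc (toℕ i ∸ g)
      length≤ = ≤-reflexive (trans (length-drop g σx)
                  (trans (cong (_∸ g) (trans (length-tabulate (σL ∘ x)) (sym 1+i≡1+d))) (+-∸-assoc 1 g≤i)))

  block : ∀ i → ∃[ u ] ∃[ v ] (w₀ ≡ u ++ σL (x i) ++ v × length u ≡ l i)
  block i with <-≤-connex (toℕ i) g
  ... | inj₁ i<g = concat (take (toℕ i) (take g σx)) , _ ,
                   trans (sym left≡w₀) (concat-split (take g σx) (toℕ i) (row-left i i<g)) , sym (l-left i i<g)
  ... | inj₂ g≤i = concat (take (toℕ i ∸ g) (drop g σx)) , _ ,
                   trans (sym right≡w₀) (concat-split (drop g σx) (toℕ i ∸ g) (row-right i g≤i)) , sym (l-right i g≤i)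

  r≤m : ∀ i → r i ≤ m
  r≤m i with block i
  ... | u , v , w₀≡ , u≡ = begin
      r i                              ≡⟨ cong (_+ len i) u≡ ⟨
      length u + len i                 ≤⟨ +-monoʳ-≤ (length u) (m≤m+n (len i) (length v)) ⟩
      length u + (len i + length v)    ≡⟨ cong (length u +_) (length-++ (σL (x i))) ⟨
      length u + length (σL (x i) ++ v) ≡⟨ length-++ u ⟨
      length (u ++ σL (x i) ++ v)      ≡⟨ cong length w₀≡ ⟨
      m                                ∎
    where open ≤-Reasoning

  InBlock : Fin (suc d) → ℕ → Set
  InBlock i a = l i ≤ a × a ≤ r i

  inBlock-offset : ∀ {i a} → InBlock i a → a ∸ l i ≤ len i
  inBlock-offset {i} {a} (_ , a≤r) = subst (a ∸ l i ≤_) (m+n∸m≡n (l i) (len i)) (∸-monoˡ-≤ (l i) a≤r)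

  inBlock-+ : ∀ i {μ} → μ ≤ len i → InBlock i (l i + μ)
  inBlock-+ i μ≤ = m≤m+n (l i) _ , +-monoʳ-≤ (l i) μ≤

  sub-block : ∀ {i a b} → InBlock i a → InBlock i b → sub barΓ w₀ a b ≡ sub barΓ (σL (x i)) (a ∸ l i) (b ∸ l i)
  sub-block {i} {a} {b} a∈ b∈ with block i
  ... | u , v , w₀≡ , u≡ = begin
      sub barΓ w₀ a b
        ≡⟨ cong₂ (sub barΓ w₀) (m+[n∸m]≡n (proj₁ a∈)) (m+[n∸m]≡n (proj₁ b∈)) ⟨
      sub barΓ w₀ (l i + (a ∸ l i)) (l i + (b ∸ l i))
        ≡⟨ cong₂ (λ w c → sub barΓ w (c + (a ∸ l i)) (c + (b ∸ l i))) w₀≡ (sym u≡) ⟩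
      sub barΓ (u ++ σL (x i) ++ v) (length u + (a ∸ l i)) (length u + (b ∸ l i))
        ≡⟨ sub-++ u (σL (x i)) v (inBlock-offset a∈) (inBlock-offset b∈) ⟩
      sub barΓ (σL (x i)) (a ∸ l i) (b ∸ l i) ∎
    where open ≡-Reasoning

  -- Steps of ∼ as translations and reflections of blocks

  barL-involutive : ∀ y → barL (barL y) ≡ y
  barL-involutive (inj₁ a) = cong inj₁ (barΓ-involutive a)
  barL-involutive (inj₂ X) = cong inj₂ (barΩ-involutive X)

  σL-barL : ∀ y → σL (barL y) ≡ barW barΓ (σL y)
  σL-barL (inj₁ a) = refl
  σL-barL (inj₂ X) = σ-bar X

  data Match (i j : Fin (suc d)) : Set where
    agree : x i ≡ x j → Match i j
    opposite : x i ≡ barL (x j) → Match i j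

  transfer : ∀ {i j} → Match i j → ℕ → ℕ
  transfer {i} {j} (agree _) a = l j + (a ∸ l i)
  transfer {i} {j} (opposite _) a = r j ∸ (a ∸ l i)

  len-match : ∀ {i j} → Match i j → len i ≡ len j
  len-match (agree x≡) = cong (length ∘ σL) x≡
  len-match {i} {j} (opposite x≡) = trans (cong (length ∘ σL) x≡) (trans (cong length (σL-barL (x j))) (length-barW (σL (x j))))

  record Step (a b c e : ℕ) : Set where
    constructor step
    field
      {i j} : Fin (suc d)
      match : Match i j
      a∈ : InBlock i a
      b∈ : InBlock i b
      c≡ : c ≡ transfer match a
      e≡ : e ≡ transfer match b

  ∼⇒step : ∀ {a b c e} → (a , b) ∼ (c , e) → Step a b c e
  ∼⇒step (same i j μ ν μ≤ ν≤ x≡) =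
    step (agree x≡) (inBlock-+ i μ≤) (inBlock-+ i ν≤)
      (cong (l j +_) (sym (m+n∸m≡n (l i) μ))) (cong (l j +_) (sym (m+n∸m≡n (l i) ν)))
  ∼⇒step (dual i j μ ν μ≤ ν≤ x≡) =
    step (opposite x≡) (inBlock-+ i μ≤) (inBlock-+ i ν≤)
      (cong (r j ∸_) (sym (m+n∸m≡n (l i) μ))) (cong (r j ∸_) (sym (m+n∸m≡n (l i) ν)))

  transfer-∼ : ∀ {i j a b} (κ : Match i j) → InBlock i a → InBlock i b → (a , b) ∼ (transfer κ a , transfer κ b)
  transfer-∼ {i} {j} {a} {b} (agree x≡) a∈ b∈ =
    subst₂ (λ a′ b′ → (a′ , b′) ∼ (transfer (agree x≡) a , transfer (agree x≡) b))
      (m+[n∸m]≡n (proj₁ a∈)) (m+[n∸m]≡n (proj₁ b∈))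
      (same i j (a ∸ l i) (b ∸ l i) (inBlock-offset a∈) (inBlock-offset b∈) x≡)
  transfer-∼ {i} {j} {a} {b} (opposite x≡) a∈ b∈ =
    subst₂ (λ a′ b′ → (a′ , b′) ∼ (transfer (opposite x≡) a , transfer (opposite x≡) b))
      (m+[n∸m]≡n (proj₁ a∈)) (m+[n∸m]≡n (proj₁ b∈))
      (dual i j (a ∸ l i) (b ∸ l i) (inBlock-offset a∈) (inBlock-offset b∈) x≡)

  transfer-inBlock : ∀ {i j a} (κ : Match i j) → InBlock i a → InBlock j (transfer κ a)
  transfer-inBlock {i} {j} {a} κ@(agree _) a∈ =
    m≤m+n (l j) _ , +-monoʳ-≤ (l j) (subst (a ∸ l i ≤_) (len-match κ) (inBlock-offset a∈))
  transfer-inBlock {i} {j} {a} κ@(opposite _) a∈ =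
    subst (_≤ r j ∸ (a ∸ l i)) (m+n∸n≡m (l j) (len j))
      (∸-monoʳ-≤ (r j) (subst (a ∸ l i ≤_) (len-match κ) (inBlock-offset a∈))) ,
    m∸n≤m (r j) (a ∸ l i)

  transfer-monotone : ∀ {i j} (κ : Match i j) → MonotoneOn (InBlock i) (transfer κ)
  transfer-monotone {i} {j} (agree _) = inj₁ record
    { mono-≤ = λ _ _ a≤b → +-monoʳ-≤ (l j) (∸-monoˡ-≤ (l i) a≤b)
    ; mono-< = λ a∈ _ a<b → +-monoʳ-< (l j) (∸-monoˡ-< a<b (proj₁ a∈))
    ; suc-commute = λ { {a} a∈ _ refl → sym (trans (cong (l j +_) (+-∸-assoc 1 (proj₁ a∈))) (+-suc (l j) (a ∸ l i))) }
    }
  transfer-monotone {i} {j} κ@(opposite _) = inj₂ record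
    { anti-≤ = λ _ _ a≤b → ∸-monoʳ-≤ (r j) (∸-monoˡ-≤ (l i) a≤b)
    ; anti-< = λ a∈ b∈ a<b → ∸-monoʳ-< (∸-monoˡ-< a<b (proj₁ a∈)) (offset≤r b∈)
    ; suc-reflect = λ { a∈ b∈ refl → trans (cong (λ c → suc (r j ∸ c)) (+-∸-assoc 1 (proj₁ a∈)))
                                         (sym (+-∸-assoc 1 (subst (_≤ r j) (+-∸-assoc 1 (proj₁ a∈)) (offset≤r b∈)))) }
    }
    where
      offset≤r : ∀ {b} → InBlock i b → b ∸ l i ≤ r j
      offset≤r b∈ = ≤-trans (subst (_ ≤_) (len-match κ) (inBlock-offset b∈)) (m≤n+m (len j) (l j))

  transfer-inverse : ∀ {i j} (κ : Match i j) →
                     Σ (Match j i) λ κ′ → ∀ {a} → InBlock i a → transfer κ′ (transfer κ a) ≡ a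
  transfer-inverse {i} {j} (agree x≡) = agree (sym x≡) , λ {a} a∈ →
    trans (cong (l i +_) (m+n∸m≡n (l j) (a ∸ l i))) (m+[n∸m]≡n (proj₁ a∈))
  transfer-inverse {i} {j} κ@(opposite x≡) = opposite (trans (sym (barL-involutive (x j))) (cong barL (sym x≡))) , λ {a} a∈ →
    begin
      r i ∸ ((l j + len j) ∸ (a ∸ l i) ∸ l j) ≡⟨ cong (r i ∸_) ([m+n]∸o∸m≡n∸o (l j) (len j) (a ∸ l i)) ⟩
      r i ∸ (len j ∸ (a ∸ l i))               ≡⟨ cong (λ c → r i ∸ (c ∸ (a ∸ l i))) (len-match κ) ⟨
      (l i + len i) ∸ (len i ∸ (a ∸ l i))     ≡⟨ [m+n]∸[n∸o]≡m+o (l i) (inBlock-offset a∈) ⟩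
      l i + (a ∸ l i)                         ≡⟨ m+[n∸m]≡n (proj₁ a∈) ⟩
      a                                       ∎
    where open ≡-Reasoning

  ∼-sym : ∀ {p q} → p ∼ q → q ∼ p
  ∼-sym {a , b} s with ∼⇒step s
  ... | step κ a∈ b∈ refl refl with transfer-inverse κ
  ...   | κ′ , inverse = subst₂ (λ a′ b′ → (transfer κ a , transfer κ b) ∼ (a′ , b′)) (inverse a∈) (inverse b∈)
                           (transfer-∼ κ′ (transfer-inBlock κ a∈) (transfer-inBlock κ b∈))

  ≈-sym : ∀ {p q} → p ≈ q → q ≈ p
  ≈-sym = Star.reverse ∼-sym

  swap : Interval → Interval
  swap (a , b) = b , a

  ∼-swap : ∀ {p q} → p ∼ q → swap p ∼ swap q
  ∼-swap (same i j μ ν μ≤ ν≤ x≡) = same i j ν μ ν≤ μ≤ x≡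
  ∼-swap (dual i j μ ν μ≤ ν≤ x≡) = dual i j ν μ ν≤ μ≤ x≡

  ≈-swap : ∀ {p q} → p ≈ q → swap p ≈ swap q
  ≈-swap = Star.gmap swap ∼-swap

  ∼-bounded : ∀ {a b c e} → (a , b) ∼ (c , e) → c ≤ m × e ≤ m
  ∼-bounded s with ∼⇒step s
  ... | step {j = j} κ a∈ b∈ refl refl =
    ≤-trans (proj₂ (transfer-inBlock κ a∈)) (r≤m j) , ≤-trans (proj₂ (transfer-inBlock κ b∈)) (r≤m j)

  sub-transfer : ∀ {i j a b} (κ : Match i j) → InBlock i a → InBlock i b →
                 sub barΓ (σL (x i)) (a ∸ l i) (b ∸ l i) ≡ sub barΓ (σL (x j)) (transfer κ a ∸ l j) (transfer κ b ∸ l j)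
  sub-transfer {i} {j} {a} {b} (agree x≡) _ _ = begin
      sub barΓ (σL (x i)) (a ∸ l i) (b ∸ l i)
        ≡⟨ cong (λ y → sub barΓ (σL y) (a ∸ l i) (b ∸ l i)) x≡ ⟩
      sub barΓ (σL (x j)) (a ∸ l i) (b ∸ l i)
        ≡⟨ cong₂ (sub barΓ (σL (x j))) (m+n∸m≡n (l j) (a ∸ l i)) (m+n∸m≡n (l j) (b ∸ l i)) ⟨
      sub barΓ (σL (x j)) ((l j + (a ∸ l i)) ∸ l j) ((l j + (b ∸ l i)) ∸ l j) ∎
    where open ≡-Reasoning
  sub-transfer {i} {j} {a} {b} κ@(opposite x≡) a∈ b∈ = begin
      sub barΓ (σL (x i)) (a ∸ l i) (b ∸ l i)
        ≡⟨ sub-barW (σL (x i)) (inBlock-offset a∈) (inBlock-offset b∈) ⟨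
      sub barΓ (barW barΓ (σL (x i))) (len i ∸ (a ∸ l i)) (len i ∸ (b ∸ l i))
        ≡⟨ cong₂ (λ w c → sub barΓ w (c ∸ (a ∸ l i)) (c ∸ (b ∸ l i))) barW-σxi (len-match κ) ⟩
      sub barΓ (σL (x j)) (len j ∸ (a ∸ l i)) (len j ∸ (b ∸ l i))
        ≡⟨ cong₂ (sub barΓ (σL (x j)))
                 ([m+n]∸o∸m≡n∸o (l j) (len j) (a ∸ l i)) ([m+n]∸o∸m≡n∸o (l j) (len j) (b ∸ l i)) ⟨
      sub barΓ (σL (x j)) (r j ∸ (a ∸ l i) ∸ l j) (r j ∸ (b ∸ l i) ∸ l j) ∎
    where
      open ≡-Reasoning
      barW-σxi : barW barΓ (σL (x i)) ≡ σL (x j)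
      barW-σxi = trans (cong (barW barΓ ∘ σL) x≡) (trans (cong (barW barΓ) (σL-barL (x j))) (barW-involutive (σL (x j))))

  ∼-sub : ∀ {a b c e} → (a , b) ∼ (c , e) → sub barΓ w₀ a b ≡ sub barΓ w₀ c e
  ∼-sub s with ∼⇒step s
  ... | step κ a∈ b∈ refl refl =
    trans (sub-block a∈ b∈) (trans (sub-transfer κ a∈ b∈) (sym (sub-block (transfer-inBlock κ a∈) (transfer-inBlock κ b∈))))

  ≈-sub : ∀ {a b c e} → (a , b) ≈ (c , e) → sub barΓ w₀ a b ≡ sub barΓ w₀ c e
  ≈-sub ε = refl
  ≈-sub (s ◅ path) = trans (∼-sub s) (≈-sub path)

  -- Free intervals

  NoCutInside : Interval → Set
  NoCutInside (a , b) = ∀ γ → IsCut γ → ¬ StrictlyBetween γ a b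

  Free′ : Interval → Set
  Free′ = Free w₀

  free⇒noCutInside : ∀ {a b c e} → Free′ (a , b) → (a , b) ≈ (c , e) → NoCutInside (c , e)
  free⇒noCutInside free path γ cut inside = proj₂ free _ _ path γ cut (strictlyBetween⇒⊓<×<⊔ inside)

  free-intro : ∀ {a b} → a ≤ m → b ≤ m → (∀ {c e} → (a , b) ≈ (c , e) → NoCutInside (c , e)) → Free′ (a , b)
  free-intro a≤m b≤m noCut = (a≤m , b≤m) , λ _ _ path γ cut inside → noCut path γ cut (⊓<×<⊔⇒strictlyBetween inside)

  free-∼ : ∀ {p q} → Free′ p → p ∼ q → Free′ q
  free-∼ free s = free-intro (proj₁ (∼-bounded s)) (proj₂ (∼-bounded s)) λ path → free⇒noCutInside free (s ◅ path)

  free-≈ : ∀ {p q} → Free′ p → p ≈ q → Free′ q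
  free-≈ free ε = free
  free-≈ free (s ◅ path) = free-≈ (free-∼ free s) path

  free-swap : ∀ {a b} → Free′ (a , b) → Free′ (b , a)
  free-swap free@((a≤m , b≤m) , _) = free-intro b≤m a≤m λ path γ cut inside →
    free⇒noCutInside free (≈-swap path) γ cut (strictlyBetween-swap inside)

  adjacent-≈ : ∀ {a b c e} → Adjacent a b → (a , b) ≈ (c , e) → Adjacent c e
  adjacent-≈ adj ε = adj
  adjacent-≈ adj (s ◅ path) with ∼⇒step s
  ... | step κ a∈ b∈ refl refl = adjacent-≈ (adjacent-preserved (transfer-monotone κ) a∈ b∈ adj) path

  adjacent-free : ∀ {c} → suc c ≤ m → Free′ (c , suc c)
  adjacent-free 1+c≤m = free-intro (<⇒≤ 1+c≤m) 1+c≤m λ path γ _ →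
    adjacent⇒¬strictlyBetween (adjacent-≈ (inj₁ refl) path)

  ≢-≈ : ∀ {a b c e} → a ≢ b → (a , b) ≈ (c , e) → c ≢ e
  ≢-≈ a≢b ε = a≢b
  ≢-≈ a≢b (s ◅ path) with ∼⇒step s
  ... | step κ a∈ b∈ refl refl = ≢-≈ (≢-preserved (transfer-monotone κ) a∈ b∈ a≢b) path

  isCut-l : ∀ i → IsCut (l i)
  isCut-l i = i , inj₁ refl

  isCut-r : ∀ i → IsCut (r i)
  isCut-r i = i , inj₂ refl

  inBlock⊎cutInside : ∀ {i A B a b} → Between a A B → Between b A B → a ≢ b → InBlock i a → InBlock i b →
                      (InBlock i A × InBlock i B) ⊎ ∃[ γ ] (IsCut γ × StrictlyBetween γ A B)
  inBlock⊎cutInside {i} a∈ b∈ a≢b a∈i b∈i with covers⊎splits a∈ b∈ a≢b a∈i b∈i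
  ... | inj₁ AB∈i = inj₁ AB∈i
  ... | inj₂ (inj₁ l-inside) = inj₂ (l i , isCut-l i , l-inside)
  ... | inj₂ (inj₂ r-inside) = inj₂ (r i , isCut-r i , r-inside)

  -- The block of each ∼-step cannot end strictly inside the free interval [A, B],
  -- so all of [A, B] is carried along with (a , b).
  interior-≈-¬cut : ∀ {A B a b p q} → Free′ (A , B) → Between a A B → StrictlyBetween b A B → a ≢ b →
                    (a , b) ≈ (p , q) → ¬ IsCut q
  interior-≈-¬cut free a∈ b∈ a≢b ε cut = free⇒noCutInside free ε _ cut b∈
  interior-≈-¬cut {A} {B} free a∈ b∈ a≢b (s ◅ path) cut with ∼⇒step s
  ... | step κ a∈i b∈i refl refl with inBlock⊎cutInside a∈ (strictlyBetween⇒between b∈) a≢b a∈i b∈i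
  ...   | inj₂ (γ , γ-cut , γ-inside) = free⇒noCutInside free ε γ γ-cut γ-inside
  ...   | inj₁ (A∈i , B∈i) =
    interior-≈-¬cut (free-∼ free (transfer-∼ κ A∈i B∈i))
      (between-preserved mono a∈i A∈i B∈i a∈) (strictlyBetween-preserved mono b∈i A∈i B∈i b∈)
      (≢-preserved mono a∈i b∈i a≢b) path cut
    where mono = transfer-monotone κ

  stepAway-≈ : ∀ {A a b P Q} → StepAway A a b → (A , b) ≈ (P , Q) → ∃[ p ] ((a , b) ≈ (p , Q) × StepAway P p Q)
  stepAway-≈ {a = a} away ε = a , ε , away
  stepAway-≈ away (s ◅ path) with ∼⇒step s
  ... | step κ A∈i b∈i refl refl =
    map₂ (map₁ (transfer-∼ κ a∈i b∈i ◅_))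
      (stepAway-≈ (stepAway-preserved (transfer-monotone κ) A∈i a∈i b∈i away) path)
    where a∈i = between-convex A∈i b∈i (stepAway⇒between away)

  -- A cut strictly inside an image of the widened interval lies strictly inside
  -- the corresponding image of (α , β) or is its first endpoint.
  stepAway-free : ∀ {A α β} → Free′ (α , β) → (∀ {p q} → (α , β) ≈ (p , q) → ¬ IsCut p) →
                  A ≤ m → StepAway A α β → Free′ (A , β)
  stepAway-free {α = α} {β} free no-cut A≤m away = free-intro A≤m (proj₂ (proj₁ free)) noCut
    where
      noCut : ∀ {c e} → (_ , β) ≈ (c , e) → NoCutInside (c , e)
      noCut path γ cut inside with stepAway-≈ away path
      ... | p , path′ , away′ with stepAway-strictlyBetween away′ inside
      ...   | inj₁ inside′ = free⇒noCutInside free path′ γ cut inside′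
      ...   | inj₂ refl = no-cut path′ cut

  -- Maximal free intervals

  MaximalFree′ : Interval → Set
  MaximalFree′ = MaximalFree w₀

  maximalFree-swap : ∀ {α β} → MaximalFree′ (α , β) → MaximalFree′ (β , α)
  maximalFree-swap {α} {β} (free , maximal) = free-swap free , λ { (a′ , b′ , free′ , a′≤ , ≤b′ , shorter) →
    maximal (a′ , b′ , free′ , subst (a′ ≤_) (⊓-comm β α) a′≤ , subst (_≤ b′) (⊔-comm β α) ≤b′ ,
             subst (_< b′ ∸ a′) (∣-∣-comm α β) shorter) }

  ¬maximal-≤ : ∀ {α β a′ b′} → MaximalFree′ (α , β) → α ≤ β →
               Free′ (a′ , b′) → a′ ≤ α → β ≤ b′ → β ∸ α < b′ ∸ a′ → ⊥
  ¬maximal-≤ {α} {β} {a′} {b′} (_ , maximal) α≤β free′ a′≤α β≤b′ shorter =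
    maximal (a′ , b′ , free′ , subst (a′ ≤_) (sym (m≤n⇒m⊓n≡m α≤β)) a′≤α ,
             subst (_≤ b′) (sym (m≤n⇒m⊔n≡n α≤β)) β≤b′ ,
             subst (_< b′ ∸ a′) (sym (m≤n⇒∣n-m∣≡n∸m α≤β)) shorter)

  ¬maximal-≥ : ∀ {α β a′ b′} → MaximalFree′ (α , β) → β ≤ α →
               Free′ (a′ , b′) → a′ ≤ β → α ≤ b′ → α ∸ β < b′ ∸ a′ → ⊥
  ¬maximal-≥ mf = ¬maximal-≤ (maximalFree-swap mf)

  1≤m : 1 ≤ m
  1≤m = ≤-trans (1≤length (σL (x fzero)) (σx≢[] fzero))
                (subst (_≤ m) (cong (_+ len fzero) (l≡0-first fzero refl)) (r≤m fzero))
    where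
      1≤length : ∀ (w : Word) → w ≢ [] → 1 ≤ length w
      1≤length [] w≢[] = ⊥-elim (w≢[] refl)
      1≤length (_ ∷ _) _ = s≤s z≤n

  adjacent-around : ∀ {α} → α ≤ m → ∃[ c ] (suc c ≤ m × c ≤ α × α ≤ suc c)
  adjacent-around {α} α≤m with α <? m
  ... | yes α<m = α , α<m , ≤-refl , n≤1+n α
  ... | no α≮m = pred m , ≤-reflexive 1+pred-m≡m , ≤-trans pred[n]≤n m≤α , ≤-trans α≤m (≤-reflexive (sym 1+pred-m≡m))
    where
      m≤α = ≮⇒≥ α≮m
      1+pred-m≡m : suc (pred m) ≡ m
      1+pred-m≡m = suc-pred m {{>-nonZero 1≤m}}

  maximalFree-nondegenerate : ∀ {α β} → MaximalFree′ (α , β) → α ≢ β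
  maximalFree-nondegenerate {α} mf@(((α≤m , _) , _) , _) refl with adjacent-around α≤m
  ... | c , c<m , c≤α , α≤1+c = ¬maximal-≤ mf ≤-refl (adjacent-free c<m) c≤α α≤1+c
    (subst₂ _<_ (sym (n∸n≡0 α)) (sym (+-∸-assoc 1 (≤-refl {c}))) (s≤s z≤n))

  g-index : Fin (suc d)
  g-index = fromℕ< (s≤s g≤d)

  toℕ-g-index : toℕ g-index ≡ g
  toℕ-g-index = toℕ-fromℕ< (s≤s g≤d)

  1+pred-g≡g : suc (pred g) ≡ g
  1+pred-g≡g = suc-pred g {{>-nonZero (≤-trans (s≤s z≤n) 2≤g)}}

  pred-g-index : Fin (suc d)
  pred-g-index = fromℕ< (s≤s (≤-trans pred[n]≤n g≤d))

  1+toℕ-pred-g-index : suc (toℕ pred-g-index) ≡ g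
  1+toℕ-pred-g-index = trans (cong suc (toℕ-fromℕ< (s≤s (≤-trans pred[n]≤n g≤d)))) 1+pred-g≡g

  isCut-0 : IsCut 0
  isCut-0 = fzero , inj₁ (sym (l≡0-first fzero refl))

  isCut-m : IsCut m
  isCut-m = pred-g-index , inj₂ (sym (r≡m-middle pred-g-index 1+toℕ-pred-g-index))

  maximalFree-cutˡ : ∀ {α β} → MaximalFree′ (α , β) → ¬ (∀ {p q} → (α , β) ≈ (p , q) → ¬ IsCut p)
  maximalFree-cutˡ {α} {β} mf@(free@((α≤m , _) , _) , _) no-cut with α ≟ 0 | α ≟ m | <-cmp α β
  ... | yes refl | _ | _ = no-cut ε isCut-0
  ... | no _ | yes refl | _ = no-cut ε isCut-m
  ... | no _ | no _ | tri≈ _ α≡β _ = maximalFree-nondegenerate mf α≡β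
  ... | no α≢0 | no _ | tri< α<β _ _ =
    ¬maximal-≤ mf (<⇒≤ α<β) (stepAway-free free no-cut (≤-trans pred[n]≤n α≤m) (inj₁ (1+pred-α≡α , α<β)))
      pred[n]≤n ≤-refl (∸-monoʳ-< (≤-reflexive 1+pred-α≡α) (<⇒≤ α<β))
    where 1+pred-α≡α = suc-pred α {{≢-nonZero α≢0}}
  ... | no _ | no α≢m | tri> _ _ β<α =
    ¬maximal-≥ mf (<⇒≤ β<α) (free-swap (stepAway-free free no-cut (≤∧≢⇒< α≤m α≢m) (inj₂ (refl , β<α))))
      ≤-refl (n≤1+n α) (∸-monoˡ-< (n<1+n α) (<⇒≤ β<α))

  maximalFree-cutʳ : ∀ {α β} → MaximalFree′ (α , β) → ¬ (∀ {p q} → (α , β) ≈ (p , q) → ¬ IsCut q)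
  maximalFree-cutʳ mf no-cut = maximalFree-cutˡ (maximalFree-swap mf) λ path → no-cut (≈-swap path)

  maximalFree-≈-¬strictlyInside : ∀ {α β p q A B} → MaximalFree′ (α , β) → (α , β) ≈ (p , q) →
                                  Free′ (A , B) → Between p A B → ¬ StrictlyBetween q A B
  maximalFree-≈-¬strictlyInside mf path free p∈ q∈ = maximalFree-cutʳ mf λ path′ →
    interior-≈-¬cut free p∈ q∈ (≢-≈ (maximalFree-nondegenerate mf) path) (≈-sym path ◅◅ path′)

  -- The bound on |Γ|

  noCutInside? : ∀ t → Dec (NoCutInside t)
  noCutInside? (a , b) = map′ fromBounds toBounds
    (all-Fin? λ i → ¬? (strictlyBetween? (l i) a b) ×-dec ¬? (strictlyBetween? (r i) a b))
    where
      fromBounds : (∀ i → ¬ StrictlyBetween (l i) a b × ¬ StrictlyBetween (r i) a b) → NoCutInside (a , b)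
      fromBounds h γ (i , inj₁ refl) = proj₁ (h i)
      fromBounds h γ (i , inj₂ refl) = proj₂ (h i)
      toBounds : NoCutInside (a , b) → ∀ i → ¬ StrictlyBetween (l i) a b × ¬ StrictlyBetween (r i) a b
      toBounds noCut i = noCut (l i) (isCut-l i) , noCut (r i) (isCut-r i)

  StepVia : Fin (suc d) → Fin (suc d) → ℕ → ℕ → ℕ → ℕ → Set
  StepVia i j a b c e =
      (x i ≡ x j × InBlock i a × InBlock i b × c ≡ l j + (a ∸ l i) × e ≡ l j + (b ∸ l i))
    ⊎ (x i ≡ barL (x j) × InBlock i a × InBlock i b × c ≡ r j ∸ (a ∸ l i) × e ≡ r j ∸ (b ∸ l i))

  ∼? : ∀ p q → Dec (p ∼ q)
  ∼? (a , b) (c , e) = map′ fromVia toVia (any-Fin? λ i → any-Fin? λ j → via? i j)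
    where
      x≟ : ∀ (y z : Fin n ⊎ Fin k) → Dec (y ≡ z)
      x≟ = ⊎-≡-dec _≟ᶠ_ _≟ᶠ_
      inBlock? : ∀ i a → Dec (InBlock i a)
      inBlock? i a = (l i ≤? a) ×-dec (a ≤? r i)
      via? : ∀ i j → Dec (StepVia i j a b c e)
      via? i j =
          (x≟ (x i) (x j) ×-dec inBlock? i a ×-dec inBlock? i b
             ×-dec c ≟ l j + (a ∸ l i) ×-dec e ≟ l j + (b ∸ l i))
        ⊎-dec (x≟ (x i) (barL (x j)) ×-dec inBlock? i a ×-dec inBlock? i b
             ×-dec c ≟ r j ∸ (a ∸ l i) ×-dec e ≟ r j ∸ (b ∸ l i))
      fromVia : (∃[ i ] ∃[ j ] StepVia i j a b c e) → (a , b) ∼ (c , e)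
      fromVia (i , j , inj₁ (x≡ , a∈ , b∈ , refl , refl)) = transfer-∼ (agree x≡) a∈ b∈
      fromVia (i , j , inj₂ (x≡ , a∈ , b∈ , refl , refl)) = transfer-∼ (opposite x≡) a∈ b∈
      toVia : (a , b) ∼ (c , e) → ∃[ i ] ∃[ j ] StepVia i j a b c e
      toVia s with ∼⇒step s
      ... | step {i} {j} (agree x≡) a∈ b∈ c≡ e≡ = i , j , inj₁ (x≡ , a∈ , b∈ , c≡ , e≡)
      ... | step {i} {j} (opposite x≡) a∈ b∈ c≡ e≡ = i , j , inj₂ (x≡ , a∈ , b∈ , c≡ , e≡)

  intervals : List Interval
  intervals = cartesianProduct (upTo (suc m)) (upTo (suc m))

  ∈-intervals : ∀ {a b} → a ≤ m → b ≤ m → (a , b) ∈ intervals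
  ∈-intervals a≤m b≤m = ∈-cartesianProduct⁺ (∈-upTo⁺ (s≤s a≤m)) (∈-upTo⁺ (s≤s b≤m))

  free? : ∀ a b → Dec (Free′ (a , b))
  free? a b with a ≤? m | b ≤? m
  ... | no a≰m | _ = no (a≰m ∘ proj₁ ∘ proj₁)
  ... | yes _ | no b≰m = no (b≰m ∘ proj₂ ∘ proj₁)
  ... | yes a≤m | yes b≤m =
    map′ (λ noCut → free-intro a≤m b≤m (noCut _)) (λ free → λ { (c , e) → free⇒noCutInside free })
      (∀-reachable? noCutInside?)
    where
      open FiniteReachability (×-≡-dec _≟_ _≟_) ∼? intervals
             (λ s → ∈-intervals (proj₁ (∼-bounded s)) (proj₂ (∼-bounded s))) (a , b) (∈-intervals a≤m b≤m)

  extentUp : ℕ → ℕ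
  extentUp p = greatest (λ t → free? p (p + t)) m

  extentDown : ℕ → ℕ
  extentDown p = greatest (λ t → free? p (p ∸ t)) p

  wordUp : ℕ → Word
  wordUp p = sub barΓ w₀ p (p + extentUp p)

  wordDown : ℕ → Word
  wordDown p = sub barΓ w₀ p (p ∸ extentDown p)

  maximalFree-wordUp : ∀ {α β p q} → MaximalFree′ (α , β) → (α , β) ≈ (p , q) → p < q →
                       sub barΓ w₀ α β ≡ wordUp p
  maximalFree-wordUp {p = p} {q} mf path p<q
    with m≤n⇒m<n∨m≡n (≤greatest (λ t → free? p (p + t)) m free-p+t t≤m)
    where
      p+t≡q = m+[n∸m]≡n (<⇒≤ p<q)
      free-pq = free-≈ (proj₁ mf) path
      free-p+t = subst (λ c → Free′ (p , c)) (sym p+t≡q) free-pq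
      t≤m = ≤-trans (m∸n≤m q p) (proj₂ (proj₁ free-pq))
  ... | inj₂ t≡T = trans (≈-sub path) (cong (sub barΓ w₀ p) (trans (sym (m+[n∸m]≡n (<⇒≤ p<q))) (cong (p +_) t≡T)))
  ... | inj₁ t<T = ⊥-elim (maximalFree-≈-¬strictlyInside mf path
      (greatest-satisfies (λ t → free? p (p + t)) m (≤-<-trans z≤n t<T))
      (inj₁ (≤-refl , m≤m+n p (extentUp p)))
      (inj₁ (p<q , subst (_< p + extentUp p) (m+[n∸m]≡n (<⇒≤ p<q)) (+-monoʳ-< p t<T))))

  maximalFree-wordDown : ∀ {α β p q} → MaximalFree′ (α , β) → (α , β) ≈ (p , q) → q < p →
                         sub barΓ w₀ α β ≡ wordDown p
  maximalFree-wordDown {p = p} {q} mf path q<p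
    with m≤n⇒m<n∨m≡n (≤greatest (λ t → free? p (p ∸ t)) p free-p∸t (m∸n≤m p q))
    where
      free-p∸t = subst (λ c → Free′ (p , c)) (sym (m∸[m∸n]≡n (<⇒≤ q<p))) (free-≈ (proj₁ mf) path)
  ... | inj₂ t≡T = trans (≈-sub path) (cong (sub barΓ w₀ p) (trans (sym (m∸[m∸n]≡n (<⇒≤ q<p))) (cong (p ∸_) t≡T)))
  ... | inj₁ t<T = ⊥-elim (maximalFree-≈-¬strictlyInside mf path
      (greatest-satisfies (λ t → free? p (p ∸ t)) p (≤-<-trans z≤n t<T))
      (inj₂ (m∸n≤m p (extentDown p) , ≤-refl))
      (inj₂ (subst (p ∸ extentDown p <_) (m∸[m∸n]≡n (<⇒≤ q<p))
                   (∸-monoʳ-< t<T (greatest≤ (λ t → free? p (p ∸ t)) p)) , q<p)))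

  g-index≢fzero : g-index ≢ fzero
  g-index≢fzero g≡0 = <⇒≱ 2≤g (≤-trans (≤-reflexive (trans (sym toℕ-g-index) (cong toℕ g≡0))) z≤n)

  cut<m⇒l : ∀ {γ} → IsCut γ → γ < m → ∃[ i ] (g-index ≢ i × γ ≡ l i)
  cut<m⇒l (i , inj₁ γ≡l) _ with g-index ≟ᶠ i
  ... | no g≢i = i , g≢i , γ≡l
  ... | yes refl = fzero , g-index≢fzero , trans γ≡l (trans (l≡0-middle g-index toℕ-g-index) (sym (l≡0-first fzero refl)))
  cut<m⇒l (i , inj₂ γ≡r) γ<m with suc (toℕ i) ≟ g | suc (toℕ i) ≟ suc d
  ... | yes 1+i≡g | _ = ⊥-elim (<-irrefl (trans γ≡r (r≡m-middle i 1+i≡g)) γ<m)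
  ... | no _ | yes 1+i≡1+d = ⊥-elim (<-irrefl (trans γ≡r (r≡m-last i 1+i≡1+d)) γ<m)
  ... | no 1+i≢g | no 1+i≢1+d = j , g≢j , trans γ≡r (r≡l-next i j toℕ-j (1+i≢g ∘ trans (sym toℕ-j)))
    where
      1+i<1+d = ≤∧≢⇒< (toℕ<n i) 1+i≢1+d
      j = fromℕ< 1+i<1+d
      toℕ-j : toℕ j ≡ suc (toℕ i)
      toℕ-j = toℕ-fromℕ< 1+i<1+d
      g≢j : g-index ≢ j
      g≢j g≡j = 1+i≢g (trans (sym toℕ-j) (trans (cong toℕ (sym g≡j)) toℕ-g-index))

  0<cut⇒r : ∀ {γ} → IsCut γ → 0 < γ → ∃[ i ] (pred-g-index ≢ i × γ ≡ r i)
  0<cut⇒r (i , inj₂ γ≡r) _ with pred-g-index ≟ᶠ i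
  ... | no pred-g≢i = i , pred-g≢i , γ≡r
  ... | yes refl = last , pred-g≢last ,
        trans γ≡r (trans (r≡m-middle pred-g-index 1+toℕ-pred-g-index) (sym (r≡m-last last (cong suc (toℕ-fromℕ d)))))
    where
      last = fromℕ d
      pred-g≢last : pred-g-index ≢ last
      pred-g≢last eq = 1+n≰n (subst (_≤ toℕ last) (trans (sym 1+toℕ-pred-g-index) (cong (suc ∘ toℕ) eq))
                                      (subst (g ≤_) (sym (toℕ-fromℕ d)) g≤d))
  0<cut⇒r (i , inj₁ γ≡l) 0<γ with toℕ i ≟ 0 | toℕ i ≟ g
  ... | yes i≡0 | _ = ⊥-elim (<-irrefl (sym (trans γ≡l (l≡0-first i i≡0))) 0<γ)
  ... | no _ | yes i≡g = ⊥-elim (<-irrefl (sym (trans γ≡l (l≡0-middle i i≡g))) 0<γ)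
  ... | no i≢0 | no i≢g = j , pred-g≢j , trans γ≡l (sym (r≡l-next j i 1+j≡i′ i≢g))
    where
      1+pred-i≡i = suc-pred (toℕ i) {{≢-nonZero i≢0}}
      pred-i<1+d = ≤-<-trans pred[n]≤n (toℕ<n i)
      j = fromℕ< pred-i<1+d
      1+j≡i′ : toℕ i ≡ suc (toℕ j)
      1+j≡i′ = sym (trans (cong suc (toℕ-fromℕ< pred-i<1+d)) 1+pred-i≡i)
      pred-g≢j : pred-g-index ≢ j
      pred-g≢j eq = i≢g (trans 1+j≡i′ (trans (cong (suc ∘ toℕ) (sym eq)) 1+toℕ-pred-g-index))

  candidates : List Word
  candidates = tabulate (wordUp ∘ l ∘ punchIn g-index) ++ tabulate (wordDown ∘ r ∘ punchIn pred-g-index)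

  length-candidates : length candidates ≡ 2 * suc d ∸ 2
  length-candidates = begin
      length candidates
        ≡⟨ length-++ (tabulate (wordUp ∘ l ∘ punchIn g-index)) ⟩
      length (tabulate (wordUp ∘ l ∘ punchIn g-index)) + length (tabulate (wordDown ∘ r ∘ punchIn pred-g-index))
        ≡⟨ cong₂ _+_ (length-tabulate (wordUp ∘ l ∘ punchIn g-index))
                     (length-tabulate (wordDown ∘ r ∘ punchIn pred-g-index)) ⟩
      d + d
        ≡⟨ cong (d +_) (+-identityʳ d) ⟨
      d + (d + 0)
        ≡⟨ cong (_∸ 1) (+-suc d (d + 0)) ⟨
      2 * suc d ∸ 2 ∎
    where open ≡-Reasoning

  wordUp-∈ : ∀ {i} → g-index ≢ i → wordUp (l i) ∈ candidates
  wordUp-∈ {i} g≢i = ∈-++⁺ˡ (subst (λ j → wordUp (l j) ∈ tabulate (wordUp ∘ l ∘ punchIn g-index))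
                                 (punchIn-punchOut g≢i) (∈-tabulate⁺ (punchOut g≢i)))

  wordDown-∈ : ∀ {i} → pred-g-index ≢ i → wordDown (r i) ∈ candidates
  wordDown-∈ {i} pred-g≢i = ∈-++⁺ʳ (tabulate (wordUp ∘ l ∘ punchIn g-index))
    (subst (λ j → wordDown (r j) ∈ tabulate (wordDown ∘ r ∘ punchIn pred-g-index)) (punchIn-punchOut pred-g≢i)
      (∈-tabulate⁺ (punchOut pred-g≢i)))

  Γ⊆candidates : ∀ w → InΓ w₀ w → w ∈ candidates
  Γ⊆candidates w (α , β , mf , w≡) = decidable-stable (w ∈? candidates) λ w∉ →
    maximalFree-cutˡ mf λ path p-cut → w∉ (from-cut path p-cut)
    where
      from-cut : ∀ {p q} → (α , β) ≈ (p , q) → IsCut p → w ∈ candidates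
      from-cut {p} {q} path p-cut with <-cmp p q
      ... | tri≈ _ p≡q _ = ⊥-elim (≢-≈ (maximalFree-nondegenerate mf) path p≡q)
      ... | tri< p<q _ _ with cut<m⇒l p-cut (<-≤-trans p<q (proj₂ (proj₁ (free-≈ (proj₁ mf) path))))
      ...   | i , g≢i , p≡l =
        subst (_∈ candidates) (sym (trans w≡ (trans (maximalFree-wordUp mf path p<q) (cong wordUp p≡l)))) (wordUp-∈ g≢i)
      from-cut {p} {q} path p-cut | tri> _ _ q<p with 0<cut⇒r p-cut (≤-<-trans z≤n q<p)
      ...   | i , pred-g≢i , p≡r =
        subst (_∈ candidates) (sym (trans w≡ (trans (maximalFree-wordDown mf path q<p) (cong wordDown p≡r))))
          (wordDown-∈ pred-g≢i)

  Γ-nonempty : ∀ w → InΓ w₀ w → w ≢ []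
  Γ-nonempty w (α , β , mf@(((α≤m , β≤m) , _) , _) , w≡) w≡[] =
    sub-≢[] w₀ α≤m β≤m (maximalFree-nondegenerate mf) (trans (sym w≡) w≡[])

  Γ-barW : ∀ w → InΓ w₀ w → InΓ w₀ (barW barΓ w)
  Γ-barW w (α , β , mf , w≡) = β , α , maximalFree-swap mf , trans (cong (barW barΓ) w≡) (sym (sub-swap w₀ α β))

proposition3 : ∀ {n k : ℕ}
    (barΓ : Fin n → Fin n) → (∀ a → barΓ (barΓ a) ≡ a) →
    (barΩ : Fin k → Fin k) → (∀ X → barΩ (barΩ X) ≡ X) → (∀ X → barΩ X ≢ X) →
    (σ : Fin k → List (Fin n)) → (∀ X → σ (barΩ X) ≡ barW barΓ (σ X)) →
    {d : ℕ} (x : Fin d → Fin n ⊎ Fin k) (g : ℕ) → 2 ≤ g → g < d →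
    (w₀ : List (Fin n)) →
    Setting.leftWord barΓ barΩ σ x g ≡ w₀ →
    Setting.rightWord barΓ barΩ σ x g ≡ w₀ →
    (∀ i → Setting.σL barΓ barΩ σ x g (x i) ≢ []) →
    (∀ w → Setting.InΓ barΓ barΩ σ x g w₀ w → w ≢ [])
    × (∃[ L ] (length L ≤ 2 * d ∸ 2 × (∀ w → Setting.InΓ barΓ barΩ σ x g w₀ w → w ∈ L)))
    × (∀ w → Setting.InΓ barΓ barΩ σ x g w₀ w → Setting.InΓ barΓ barΩ σ x g w₀ (barW barΓ w))
proposition3 barΓ barΓ-involutive barΩ barΩ-involutive _ σ σ-bar {suc d} x g 2≤g (s≤s g≤d)
             w₀ left≡w₀ right≡w₀ σx≢[] =
  Γ-nonempty , (candidates , ≤-reflexive length-candidates , Γ⊆candidates) , Γ-barW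
  where
    open FreeIntervals barΓ barΓ-involutive barΩ barΩ-involutive σ σ-bar x g 2≤g g≤d w₀ left≡w₀ right≡w₀ σx≢[]
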